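{- Let $k\ge 1$ and consider the pattern $p=r(ur)^k$. For integers $n\ge 0$ and $m\ge n$, let $s_n(m)$ be the number of ballot paths from $(0,0)$ to $(n,m)$ avoiding $p$. Then $$s_n(m)=(m-n+1)\sum_{i=0}^{n}\sum_{j\ge 0}(-1)^j\binom{i}{j}\binom{ -j}{n-i-kj}_{k+1}\frac{1}{m-n+i+1}\binom{m-n+2i}{i},$$ and the number of Dyck paths from $(0,0)$ to $(n,n)$ avoiding $p$ is $$s_n(n)=\sum_{i=0}^{n}C_i\sum_{j\ge 0}(-1)^j\binom{i}{j}\binom{ -j}{n-i-kj}_{k+1},$$ where $C_i=\frac{1}{i+1}\binom{2i}{i}$ is the $i$th Catalan number.
   Context: Paths are words over $\{u,r\}$, $u$ = up step $(0,1)$, $r$ = right step $(1,0)$. A ballot path is a path starting at the origin that stays weakly above the line $y=x$ (every prefix has at least as many $u$'s as $r$'s); a Dyck path is a ballot path ending on $y=x$. A path avoids a pattern (a finite word over $\{u,r\}$) if the pattern does not occur in it as a contiguous subword; $(ur)^k$ denotes $ur$ repeated $k$ times. For an integer $y$ and integer $s$, $\binom{y}{s}_{k+1}:=[t^s](1+t+\cdots+t^k)^{y}$, the coefficient of $t^s$ in the power series $(1+t+\cdots+t^k)^y$ (which is $0$ for $s<0$). Ordinary binomial coefficients $\binom{i}{j}$ vanish for $j>i$. -}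

module Defs where

open import Data.Nat as ℕ using (ℕ; zero; suc; _≤_; _≤?_)
open import Data.Nat.Combinatorics using (_C_)
open import Data.Integer as ℤ using (ℤ; +_; -[1+_]; 0ℤ; 1ℤ)
open import Data.Rational as ℚ using (ℚ)
open import Data.List using (List; []; _∷_; _++_; length; filter; concatMap; inits; replicate; concat)
open import Data.List.Relation.Unary.All using (All; all?)
open import Data.List.Relation.Binary.Infix.Heterogeneous using (Infix)
open import Data.List.Relation.Binary.Infix.Heterogeneous.Properties using (infix?)
open import Data.Product using (_×_)
open import Relation.Binary.PropositionalEquality using (_≡_; refl)
open import Relation.Nullary using (Dec; yes; no; ¬_)
open import Relation.Nullary.Decidable using (_×-dec_; ¬?)
open import Data.Nat.Properties using (_≟_)

data Step : Set where
  u r : Step   -- u = up step (0,1), r = right step (1,0)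

_≟S_ : (a b : Step) → Dec (a ≡ b)
u ≟S u = yes refl
u ≟S r = no (λ ())
r ≟S u = no (λ ())
r ≟S r = yes refl

Path : Set
Path = List Step

#u #r : Path → ℕ
#u [] = 0
#u (u ∷ w) = suc (#u w)
#u (r ∷ w) = #u w
#r [] = 0
#r (u ∷ w) = #r w
#r (r ∷ w) = suc (#r w)

words : ℕ → List Path
words zero = [] ∷ []
words (suc L) = concatMap (λ w → (u ∷ w) ∷ (r ∷ w) ∷ []) (words L)

Ballot : Path → Set
Ballot w = All (λ p → #r p ≤ #u p) (inits w)

ballot? : (w : Path) → Dec (Ballot w)
ballot? w = all? (λ p → #r p ≤? #u p) (inits w)

Occurs : Path → Path → Set
Occurs p w = Infix _≡_ p w

Avoids : Path → Path → Set
Avoids p w = ¬ Occurs p w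

avoids? : (p w : Path) → Dec (Avoids p w)
avoids? p w = ¬? (infix? _≟S_ p w)

urPow : ℕ → Path
urPow k = concat (replicate k (u ∷ r ∷ []))

pat : ℕ → Path
pat k = r ∷ urPow k

EndsAt : ℕ → ℕ → Path → Set
EndsAt n m w = (#r w ≡ n) × (#u w ≡ m)

endsAt? : (n m : ℕ) (w : Path) → Dec (EndsAt n m w)
endsAt? n m w = (#r w ≟ n) ×-dec (#u w ≟ m)

-- s_n(m) for pattern p: number of ballot paths from (0,0) to (n,m) avoiding p
-- (every such path has length n+m, so it is among words (n+m))
ballotAvoid : Path → ℕ → ℕ → ℕ
ballotAvoid p n m =
  length (filter (λ w → endsAt? n m w ×-dec (ballot? w ×-dec avoids? p w))
                 (words (n ℕ.+ m)))

dyckAvoid : Path → ℕ → ℕ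
dyckAvoid p n =
  length (filter (λ w → endsAt? n n w ×-dec (ballot? w ×-dec avoids? p w))
                 (words (n ℕ.+ n)))

Series : Set
Series = ℕ → ℤ

sumℤ : ℕ → (ℕ → ℤ) → ℤ
sumℤ zero f = f 0
sumℤ (suc n) f = sumℤ n f ℤ.+ f (suc n)

δ0 : Series
δ0 zero = 1ℤ
δ0 (suc _) = 0ℤ

_⊛_ : Series → Series → Series
(f ⊛ g) n = sumℤ n (λ i → f i ℤ.* g (n ℕ.∸ i))

pow : Series → ℕ → Series
pow f zero = δ0
pow f (suc e) = f ⊛ pow f e

-- multiplicative inverse of a series with constant term 1:
-- f = 1 - g, g(0) = 0, f⁻¹ = Σ_e g^e, and [t^n] only needs e ≤ n
inv : Series → Series
inv f n = sumℤ n (λ e → pow g e n)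
  where
  g : Series
  g i = δ0 i ℤ.- f i

geomPoly : ℕ → Series
geomPoly k i with i ≤? k
... | yes _ = 1ℤ
... | no _ = 0ℤ

geomPow : ℕ → ℤ → Series
geomPow k (+ y) = pow (geomPoly k) y
geomPow k -[1+ y ] = pow (inv (geomPoly k)) (suc y)

-- binom(y, s)_{k+1} = [t^s] (1 + t + ... + t^k)^y, zero for s < 0
gbinom : ℕ → ℤ → ℤ → ℤ
gbinom k y (+ s) = geomPow k y s
gbinom k y -[1+ _ ] = 0ℤ

sumℚ : ℕ → (ℕ → ℚ) → ℚ
sumℚ zero f = f 0
sumℚ (suc n) f = sumℚ n f ℚ.+ f (suc n)

ℕtoℚ : ℕ → ℚ
ℕtoℚ n = (+ n) ℚ./ 1

ℤtoℚ : ℤ → ℚ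
ℤtoℚ z = z ℚ./ 1

-- Σ_{j≥0} (-1)^j binom(i,j) binom(-j, n-i-kj)_{k+1};
-- terms with j > i vanish since binom(i,j) = 0, so j ranges over 0..i
innerSum : ℕ → ℕ → ℕ → ℤ
innerSum k n i =
  sumℤ i (λ j → ((ℤ.- 1ℤ) ℤ.^ j) ℤ.* (+ (i C j))
                ℤ.* gbinom k (ℤ.- (+ j)) ((+ n) ℤ.- (+ i) ℤ.- (+ (k ℕ.* j))))

catalan : ℕ → ℚ
catalan i = ((+ ((2 ℕ.* i) C i)) ℚ./ suc i)

ballotFormula : ℕ → ℕ → ℕ → ℚ
ballotFormula k n m =
  ℕtoℚ (suc (m ℕ.∸ n)) ℚ.*
  sumℚ n (λ i → ℤtoℚ (innerSum k n i)
                ℚ.* ((1ℤ ℚ./ suc (m ℕ.∸ n ℕ.+ i))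
                ℚ.* ℕtoℚ ((m ℕ.∸ n ℕ.+ 2 ℕ.* i) C i)))

dyckFormula : ℕ → ℕ → ℚ
dyckFormula k n = sumℚ n (λ i → catalan i ℚ.* ℤtoℚ (innerSum k n i))

module Submission where

open import Defs
open import Data.Nat using (ℕ; _≤_)
open import Data.Product using (_×_)
open import Relation.Binary.PropositionalEquality using (_≡_)

-- Write S n d for s_n(n + d), ΔS n d = S n d - S n (d - 1) with the convention S n (-1) = [n = 0].
-- Both sides of the formula satisfy S 0 d = 1, ΔS (n + 1) d = S n (d + 1) for n < k, and
-- ΔS (n + k + 1) d - ΔS n d = S (n + k) (d + 1) - S n (d + 1), which determine S.
--
-- For the paths this is the decomposition by the last step: a final r-step is forbidden exactly when
-- the path before it ends in (ru)ᵏ, and stripping that suffix leaves a path not ending in ru. Since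
-- r(ur)ᵏ is a palindrome, reversing paths turns this into a decomposition by the first step.
--
-- For the formula, write it as Σᵢ c n i · B d i with the ballot numbers B d i = (d + 1)/(d + i + 1)
-- binom(d + 2i, i) and c n i = [tⁿ] tⁱ (1 - tᵏ/G)ⁱ, G = 1 + t + ⋯ + tᵏ. The recurrences follow from
-- B (d + 1) (i + 1) = B d (i + 1) + B (d + 2) i and G · tⁱ⁺¹ (1 - tᵏ/G)ⁱ⁺¹ = t (1 + ⋯ + tᵏ⁻¹) · tⁱ (1 - tᵏ/G)ⁱ.

module SumProperties where

  open import Data.Nat as ℕ using (ℕ; zero; suc; _≤_; _<_; z≤n; s≤s)
  import Data.Nat.Properties as ℕP
  open import Data.Integer using (ℤ; 0ℤ; _+_; _*_; -_; _-_)
  import Data.Integer.Properties as ℤP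
  open import Data.Integer.Tactic.RingSolver using (solve-∀)
  open import Data.Product using (_,_)
  open import Function using (_∘_)
  open import Relation.Binary.PropositionalEquality

  sumℤ-cong≤ : ∀ n {f g : ℕ → ℤ} → (∀ i → i ≤ n → f i ≡ g i) → sumℤ n f ≡ sumℤ n g
  sumℤ-cong≤ zero     f≗g = f≗g 0 z≤n
  sumℤ-cong≤ (suc n) f≗g =
    cong₂ _+_ (sumℤ-cong≤ n (λ i i≤n → f≗g i (ℕP.m≤n⇒m≤1+n i≤n))) (f≗g (suc n) ℕP.≤-refl)

  sumℤ-cong : ∀ n {f g : ℕ → ℤ} → (∀ i → f i ≡ g i) → sumℤ n f ≡ sumℤ n g
  sumℤ-cong n f≗g = sumℤ-cong≤ n (λ i _ → f≗g i)

  sumℤ-zero : ∀ n {f : ℕ → ℤ} → (∀ i → i ≤ n → f i ≡ 0ℤ) → sumℤ n f ≡ 0ℤ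
  sumℤ-zero n f≗0 = trans (sumℤ-cong≤ n f≗0) (sumℤ-const-0 n)
    where
    sumℤ-const-0 : ∀ n → sumℤ n (λ _ → 0ℤ) ≡ 0ℤ
    sumℤ-const-0 zero    = refl
    sumℤ-const-0 (suc n) = cong (_+ 0ℤ) (sumℤ-const-0 n)

  sumℤ-distrib-+ : ∀ n (f g : ℕ → ℤ) → sumℤ n (λ i → f i + g i) ≡ sumℤ n f + sumℤ n g
  sumℤ-distrib-+ zero    f g = refl
  sumℤ-distrib-+ (suc n) f g rewrite sumℤ-distrib-+ n f g =
    interchange (sumℤ n f) (sumℤ n g) (f (suc n)) (g (suc n))
    where
    interchange : ∀ a b c d → a + b + (c + d) ≡ a + c + (b + d)
    interchange = solve-∀

  *-distribˡ-sumℤ : ∀ n (a : ℤ) (f : ℕ → ℤ) → a * sumℤ n f ≡ sumℤ n (λ i → a * f i)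
  *-distribˡ-sumℤ zero    a f = refl
  *-distribˡ-sumℤ (suc n) a f rewrite sym (*-distribˡ-sumℤ n a f) =
    ℤP.*-distribˡ-+ a (sumℤ n f) (f (suc n))

  *-distribʳ-sumℤ : ∀ n (a : ℤ) (f : ℕ → ℤ) → sumℤ n f * a ≡ sumℤ n (λ i → f i * a)
  *-distribʳ-sumℤ n a f =
    trans (ℤP.*-comm (sumℤ n f) a)
          (trans (*-distribˡ-sumℤ n a f) (sumℤ-cong n (λ i → ℤP.*-comm a (f i))))

  neg-distrib-sumℤ : ∀ n (f : ℕ → ℤ) → - sumℤ n f ≡ sumℤ n (λ i → - f i)
  neg-distrib-sumℤ zero    f = refl
  neg-distrib-sumℤ (suc n) f rewrite sym (neg-distrib-sumℤ n f) =
    ℤP.neg-distrib-+ (sumℤ n f) (f (suc n))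

  sumℤ-distrib-minus : ∀ n (f g : ℕ → ℤ) → sumℤ n (λ i → f i - g i) ≡ sumℤ n f - sumℤ n g
  sumℤ-distrib-minus n f g =
    trans (sumℤ-distrib-+ n f (λ i → - g i)) (cong (sumℤ n f +_) (sym (neg-distrib-sumℤ n g)))

  sumℤ-suc : ∀ n (f : ℕ → ℤ) → sumℤ (suc n) f ≡ f 0 + sumℤ n (f ∘ suc)
  sumℤ-suc zero    f = refl
  sumℤ-suc (suc n) f rewrite sumℤ-suc n f = ℤP.+-assoc (f 0) _ _

  sumℤ-comm : ∀ n m (f : ℕ → ℕ → ℤ) →
              sumℤ n (λ i → sumℤ m (f i)) ≡ sumℤ m (λ j → sumℤ n (λ i → f i j))
  sumℤ-comm zero    m f = refl
  sumℤ-comm (suc n) m f rewrite sumℤ-comm n m f =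
    sym (sumℤ-distrib-+ m (λ j → sumℤ n (λ i → f i j)) (f (suc n)))

  sumℤ-extend : ∀ {n m} {f : ℕ → ℤ} → n ≤ m → (∀ i → n < i → i ≤ m → f i ≡ 0ℤ) →
                sumℤ m f ≡ sumℤ n f
  sumℤ-extend {n} {m} {f} n≤m tail≡0 with ℕP.m≤n⇒∃[o]m+o≡n n≤m
  ... | d , refl = extend d tail≡0
    where
    extend : ∀ d → (∀ i → n < i → i ≤ n ℕ.+ d → f i ≡ 0ℤ) → sumℤ (n ℕ.+ d) f ≡ sumℤ n f
    extend zero    _ rewrite ℕP.+-identityʳ n = refl
    extend (suc d) tail≡0 rewrite ℕP.+-suc n d =
      trans (cong (sumℤ (n ℕ.+ d) f +_) (tail≡0 (suc (n ℕ.+ d)) (s≤s (ℕP.m≤m+n n d)) ℕP.≤-refl))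
            (trans (ℤP.+-identityʳ _)
                   (extend d (λ i n<i i≤n+d → tail≡0 i n<i (ℕP.m≤n⇒m≤1+n i≤n+d))))

  sumℤ-telescope : ∀ n (a : ℕ → ℤ) → sumℤ n a - sumℤ n (a ∘ suc) ≡ a 0 - a (suc n)
  sumℤ-telescope zero    a = refl
  sumℤ-telescope (suc n) a =
    trans (regroup (sumℤ n a) (sumℤ n (a ∘ suc)) (a (suc n)) (a (suc (suc n))))
          (trans (cong (λ t → t + a (suc n) - a (suc (suc n))) (sumℤ-telescope n a))
                 (cancel (a 0) (a (suc n)) (a (suc (suc n)))))
    where
    regroup : ∀ x y z w → x + z - (y + w) ≡ (x - y) + z - w
    regroup = solve-∀
    cancel : ∀ x z w → x - z + z - w ≡ x - w
    cancel = solve-∀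

module SeriesProperties where

  open SumProperties
  open import Data.Nat using (ℕ; zero; suc; _≤_; _<_; _∸_; s≤s)
  import Data.Nat.Properties as ℕP
  open import Data.Integer using (ℤ; 0ℤ; 1ℤ; _+_; _*_; -_; _-_)
  import Data.Integer.Properties as ℤP
  open import Data.Integer.Tactic.RingSolver using (solve-∀)
  open import Function using (_∘_)
  open import Relation.Binary.PropositionalEquality

  ⊛-suc : ∀ (f g : Series) n → (f ⊛ g) (suc n) ≡ f 0 * g (suc n) + ((f ∘ suc) ⊛ g) n
  ⊛-suc f g n = sumℤ-suc n (λ i → f i * g (suc n ∸ i))

  ⊛-congˡ : ∀ {f f′ : Series} (g : Series) n → (∀ i → f i ≡ f′ i) → (f ⊛ g) n ≡ (f′ ⊛ g) n
  ⊛-congˡ g n f≗f′ = sumℤ-cong n (λ i → cong (_* g (n ∸ i)) (f≗f′ i))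

  ⊛-congʳ : ∀ (f : Series) {g g′ : Series} n → (∀ i → i ≤ n → g i ≡ g′ i) →
            (f ⊛ g) n ≡ (f ⊛ g′) n
  ⊛-congʳ f n g≗g′ = sumℤ-cong n (λ i → cong (f i *_) (g≗g′ (n ∸ i) (ℕP.m∸n≤m n i)))

  ⊛-linearˡ : ∀ (a : ℤ) (f h g : Series) n →
              ((λ i → a * f i + h i) ⊛ g) n ≡ a * (f ⊛ g) n + (h ⊛ g) n
  ⊛-linearˡ a f h g n =
    trans (sumℤ-cong n (λ i → expand a (f i) (h i) (g (n ∸ i))))
          (trans (sumℤ-distrib-+ n (λ i → a * (f i * g (n ∸ i))) (λ i → h i * g (n ∸ i)))
                 (cong (_+ (h ⊛ g) n) (sym (*-distribˡ-sumℤ n a (λ i → f i * g (n ∸ i))))))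
    where
    expand : ∀ a x y z → (a * x + y) * z ≡ a * (x * z) + y * z
    expand = solve-∀

  ⊛-sumʳ : ∀ (f : Series) N (H : ℕ → Series) n →
           (f ⊛ (λ i → sumℤ N (λ e → H e i))) n ≡ sumℤ N (λ e → (f ⊛ H e) n)
  ⊛-sumʳ f N H n =
    trans (sumℤ-cong n (λ i → *-distribˡ-sumℤ N (f i) (λ e → H e (n ∸ i))))
          (sumℤ-comm n N (λ i e → f i * H e (n ∸ i)))

  ⊛-assoc : ∀ n (f g h : Series) → ((f ⊛ g) ⊛ h) n ≡ (f ⊛ (g ⊛ h)) n
  ⊛-assoc zero    f g h = ℤP.*-assoc (f 0) (g 0) (h 0)
  ⊛-assoc (suc n) f g h = begin
    ((f ⊛ g) ⊛ h) (suc n)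
      ≡⟨ ⊛-suc (f ⊛ g) h n ⟩
    f 0 * g 0 * h (suc n) + (((f ⊛ g) ∘ suc) ⊛ h) n
      ≡⟨ cong (f 0 * g 0 * h (suc n) +_)
           (trans (⊛-congˡ h n (⊛-suc f g)) (⊛-linearˡ (f 0) (g ∘ suc) ((f ∘ suc) ⊛ g) h n)) ⟩
    f 0 * g 0 * h (suc n) + (f 0 * ((g ∘ suc) ⊛ h) n + (((f ∘ suc) ⊛ g) ⊛ h) n)
      ≡⟨ cong (λ z → f 0 * g 0 * h (suc n) + (f 0 * ((g ∘ suc) ⊛ h) n + z))
              (⊛-assoc n (f ∘ suc) g h) ⟩
    f 0 * g 0 * h (suc n) + (f 0 * ((g ∘ suc) ⊛ h) n + ((f ∘ suc) ⊛ (g ⊛ h)) n)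
      ≡⟨ regroup (f 0) (g 0) (h (suc n)) (((g ∘ suc) ⊛ h) n) (((f ∘ suc) ⊛ (g ⊛ h)) n) ⟩
    f 0 * (g 0 * h (suc n) + ((g ∘ suc) ⊛ h) n) + ((f ∘ suc) ⊛ (g ⊛ h)) n
      ≡⟨ cong (λ z → f 0 * z + ((f ∘ suc) ⊛ (g ⊛ h)) n) (sym (⊛-suc g h n)) ⟩
    f 0 * (g ⊛ h) (suc n) + ((f ∘ suc) ⊛ (g ⊛ h)) n
      ≡⟨ sym (⊛-suc f (g ⊛ h) n) ⟩
    (f ⊛ (g ⊛ h)) (suc n) ∎
    where
    open ≡-Reasoning
    regroup : ∀ a b c d e → a * b * c + (a * d + e) ≡ a * (b * c + d) + e
    regroup = solve-∀

  ⊛-identityˡ : ∀ (g : Series) n → (δ0 ⊛ g) n ≡ g n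
  ⊛-identityˡ g zero    = ℤP.*-identityˡ (g 0)
  ⊛-identityˡ g (suc n) rewrite ⊛-suc δ0 g n | sumℤ-zero n {λ _ → 0ℤ} (λ _ _ → refl) =
    trans (ℤP.+-identityʳ _) (ℤP.*-identityˡ (g (suc n)))

  ⊛-vanish : ∀ (f h : Series) n → (∀ i → i ≤ n → h i ≡ 0ℤ) → (f ⊛ h) n ≡ 0ℤ
  ⊛-vanish f h n h≡0 =
    sumℤ-zero n (λ i _ → trans (cong (f i *_) (h≡0 (n ∸ i) (ℕP.m∸n≤m n i))) (ℤP.*-zeroʳ (f i)))

  pow-vanish : ∀ (g : Series) → g 0 ≡ 0ℤ → ∀ e n → n < e → pow g e n ≡ 0ℤ
  pow-vanish g g0≡0 (suc e) zero    _ = cong (_* pow g e 0) g0≡0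
  pow-vanish g g0≡0 (suc e) (suc n) (s≤s n<e) =
    trans (⊛-suc g (pow g e) n)
          (cong₂ _+_ (cong (_* pow g e (suc n)) g0≡0)
                     (⊛-vanish (g ∘ suc) (pow g e) n
                        (λ i i≤n → pow-vanish g g0≡0 e i (ℕP.≤-trans (s≤s i≤n) n<e))))

  module Inverse (f : Series) (f0≡1 : f 0 ≡ 1ℤ) where

    private
      g : Series
      g i = δ0 i - f i

      g0≡0 : g 0 ≡ 0ℤ
      g0≡0 rewrite f0≡1 = refl

      partialInv : ℕ → Series
      partialInv N m = sumℤ N (λ e → pow g e m)

      partialInv-stable : ∀ N x → x ≤ N → partialInv N x ≡ inv f x
      partialInv-stable N x x≤N = sumℤ-extend x≤N (λ e x<e _ → pow-vanish g g0≡0 e x x<e)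

      -- f · Σ_{e ≤ N} gᵉ = (1 - g) Σ_{e ≤ N} gᵉ = 1 - g^{N+1}
      ⊛-partialInv : ∀ N m → (f ⊛ partialInv N) m ≡ δ0 m - pow g (suc N) m
      ⊛-partialInv N m = begin
        (f ⊛ partialInv N) m
          ≡⟨ ⊛-congˡ (partialInv N) m (λ i → f≡1-g (δ0 i) (f i)) ⟩
        ((λ i → - 1ℤ * g i + δ0 i) ⊛ partialInv N) m
          ≡⟨ ⊛-linearˡ (- 1ℤ) g δ0 (partialInv N) m ⟩
        - 1ℤ * (g ⊛ partialInv N) m + (δ0 ⊛ partialInv N) m
          ≡⟨ cong₂ (λ a b → - 1ℤ * a + b) (⊛-sumʳ g N (pow g) m) (⊛-identityˡ (partialInv N) m) ⟩
        - 1ℤ * sumℤ N (λ e → pow g (suc e) m) + partialInv N m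
          ≡⟨ flip (sumℤ N (λ e → pow g (suc e) m)) (partialInv N m) ⟩
        partialInv N m - sumℤ N (λ e → pow g (suc e) m)
          ≡⟨ sumℤ-telescope N (λ e → pow g e m) ⟩
        δ0 m - pow g (suc N) m ∎
        where
        open ≡-Reasoning
        f≡1-g : ∀ a b → b ≡ - 1ℤ * (a - b) + a
        f≡1-g = solve-∀
        flip : ∀ a b → - 1ℤ * a + b ≡ b - a
        flip = solve-∀

    ⊛-inverseʳ : ∀ m → (f ⊛ inv f) m ≡ δ0 m
    ⊛-inverseʳ m =
      trans (⊛-congʳ f m (λ x x≤m → sym (partialInv-stable m x x≤m)))
            (trans (⊛-partialInv m m)
                   (trans (cong (λ z → δ0 m - z) (pow-vanish g g0≡0 (suc m) m ℕP.≤-refl))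
                          (ℤP.+-identityʳ (δ0 m))))

    ⊛-inv-cancelˡ : ∀ (w : Series) n → (f ⊛ (inv f ⊛ w)) n ≡ w n
    ⊛-inv-cancelˡ w n =
      trans (sym (⊛-assoc n f (inv f) w))
            (trans (⊛-congˡ w n ⊛-inverseʳ) (⊛-identityˡ w n))

module IntegerSubtraction where

  open import Data.Nat as ℕ using (_≤_; _∸_)
  open import Data.Integer using (+_; 0ℤ; _-_; _<_)
  import Data.Integer.Properties as ℤP
  open import Relation.Binary.PropositionalEquality

  +m-+n<0 : ∀ {m n} → m ℕ.< n → + m - + n < 0ℤ
  +m-+n<0 {m} {n} m<n =
    subst₂ _<_ (sym (ℤP.m-n≡m⊖n m n)) (ℤP.n⊖n≡0 m) (ℤP.⊖-monoʳ->-< m m<n)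

  i<0⇒i-+n<0 : ∀ {i} n → i < 0ℤ → i - + n < 0ℤ
  i<0⇒i-+n<0 {i} n i<0 = ℤP.≤-<-trans (ℤP.i-j≤i i (+ n)) i<0

  +m-+n≡+[m∸n] : ∀ {m n} → n ≤ m → + m - + n ≡ + (m ∸ n)
  +m-+n≡+[m∸n] {m} {n} n≤m = trans (ℤP.m-n≡m⊖n m n) (ℤP.⊖-≥ n≤m)

module NegativeGeometricPowers (k : ℕ) where

  open SumProperties
  open SeriesProperties
  open IntegerSubtraction
  open import Data.Nat as ℕ using (ℕ; zero; suc; _≤_; _<_; _∸_; _≤?_)
  import Data.Nat.Properties as ℕP
  open import Data.Integer using (ℤ; +_; -[1+_]; 0ℤ; 1ℤ; _+_; _*_; -_; _-_; +<+; -<+)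
    renaming (_<_ to _<ℤ_)
  import Data.Integer.Properties as ℤP
  open import Relation.Binary.PropositionalEquality
  open import Relation.Nullary using (yes; no; contradiction)

  geomPoly-≤ : ∀ {l} → l ≤ k → geomPoly k l ≡ 1ℤ
  geomPoly-≤ {l} l≤k with l ≤? k
  ... | yes _   = refl
  ... | no  l≰k = contradiction l≤k l≰k

  geomPoly-> : ∀ {l} → k < l → geomPoly k l ≡ 0ℤ
  geomPoly-> {l} k<l with l ≤? k
  ... | yes l≤k = contradiction l≤k (ℕP.<⇒≱ k<l)
  ... | no  _   = refl

  W : ℕ → ℤ → ℤ
  W j = gbinom k (- (+ j))

  W-+ : ∀ j s → W j (+ s) ≡ pow (inv (geomPoly k)) j s
  W-+ zero    s = refl
  W-+ (suc j) s = refl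

  W-negative : ∀ j {z} → z <ℤ 0ℤ → W j z ≡ 0ℤ
  W-negative j { -[1+ _ ]} _ = refl
  W-negative j { + _ } (+<+ ())

  -- Coefficientwise form of (1 + ⋯ + t^k) · (1 + ⋯ + t^k)^{-(j+1)} = (1 + ⋯ + t^k)^{-j}.
  W-rec : ∀ j s → sumℤ k (λ l → W (suc j) (s - + l)) ≡ W j s
  W-rec j -[1+ _ ] = sumℤ-zero k (λ l _ → W-negative (suc j) (i<0⇒i-+n<0 l -<+))
  W-rec j (+ x) = begin
    sumℤ k (λ l → W (suc j) (+ x - + l))
      ≡⟨ sumℤ-cong≤ k (λ l l≤k → sym (trans (cong (_* W (suc j) (+ x - + l)) (geomPoly-≤ l≤k)) (ℤP.*-identityˡ _))) ⟩
    sumℤ k term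
      ≡⟨ sym (sumℤ-extend (ℕP.m≤n+m k x) (λ l k<l _ → term-beyond-k k<l)) ⟩
    sumℤ (x ℕ.+ k) term
      ≡⟨ sumℤ-extend (ℕP.m≤m+n x k) (λ l x<l _ → term-beyond-x x<l) ⟩
    sumℤ x term
      ≡⟨ sumℤ-cong≤ x (λ l l≤x → cong (geomPoly k l *_) (trans (cong (W (suc j)) (+m-+n≡+[m∸n] l≤x))
                                                            (W-+ (suc j) (x ∸ l)))) ⟩
    (geomPoly k ⊛ pow (inv (geomPoly k)) (suc j)) x
      ≡⟨ Inverse.⊛-inv-cancelˡ (geomPoly k) refl (pow (inv (geomPoly k)) j) x ⟩
    pow (inv (geomPoly k)) j x
      ≡⟨ sym (W-+ j x) ⟩
    W j (+ x) ∎
    where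
    open ≡-Reasoning
    term : ℕ → ℤ
    term l = geomPoly k l * W (suc j) (+ x - + l)
    term-beyond-k : ∀ {l} → k < l → term l ≡ 0ℤ
    term-beyond-k {l} k<l = cong (_* W (suc j) (+ x - + l)) (geomPoly-> k<l)
    term-beyond-x : ∀ {l} → x < l → term l ≡ 0ℤ
    term-beyond-x {l} x<l =
      trans (cong (geomPoly k l *_) (W-negative (suc j) (+m-+n<0 x<l))) (ℤP.*-zeroʳ (geomPoly k l))

module Binomial where

  open SumProperties
  open import Data.Nat as ℕ using (ℕ; suc; _<_; _≤ᵇ_)
  import Data.Nat.Properties as ℕP
  open import Data.Nat.Combinatorics using (_C_; nCk+nC[k+1]≡[n+1]C[k+1])
  open import Data.Integer using (ℤ; +_; 1ℤ; _+_; _*_)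
  import Data.Integer.Properties as ℤP
  open import Data.Bool using (true; false; T)
  open import Relation.Binary.PropositionalEquality
  open import Relation.Nullary using (contradiction)

  n<k⇒nCk≡0 : ∀ {n k} → n < k → n C k ≡ 0
  n<k⇒nCk≡0 {n} {k} n<k with k ≤ᵇ n in eq
  ... | false = refl
  ... | true  = contradiction (ℕP.≤ᵇ⇒≤ k n (subst T (sym eq) _)) (ℕP.<⇒≱ n<k)

  sumℤ-pascal : ∀ i (b : ℕ → ℤ) →
                sumℤ (suc i) (λ j → + (suc i C j) * b j) ≡ sumℤ i (λ j → + (i C j) * (b j + b (suc j)))
  sumℤ-pascal i b = begin
    sumℤ (suc i) (λ j → + (suc i C j) * b j)
      ≡⟨ sumℤ-suc i _ ⟩
    1ℤ * b 0 + sumℤ i (λ j → + (suc i C suc j) * b (suc j))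
      ≡⟨ cong (_+_ (1ℤ * b 0)) (trans (sumℤ-cong i pascal-term) (sumℤ-distrib-+ i _ _)) ⟩
    1ℤ * b 0 + (sumℤ i (λ j → + (i C suc j) * b (suc j)) + sumℤ i (λ j → + (i C j) * b (suc j)))
      ≡⟨ sym (trans (cong (_+ sumℤ i (λ j → + (i C j) * b (suc j))) (sumℤ-suc i (λ j → + (i C j) * b j)))
                    (ℤP.+-assoc (1ℤ * b 0) _ _)) ⟩
    sumℤ (suc i) (λ j → + (i C j) * b j) + sumℤ i (λ j → + (i C j) * b (suc j))
      ≡⟨ cong (_+ sumℤ i (λ j → + (i C j) * b (suc j))) top-term-vanishes ⟩
    sumℤ i (λ j → + (i C j) * b j) + sumℤ i (λ j → + (i C j) * b (suc j))
      ≡⟨ sym (sumℤ-distrib-+ i _ _) ⟩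
    sumℤ i (λ j → + (i C j) * b j + + (i C j) * b (suc j))
      ≡⟨ sumℤ-cong i (λ j → sym (ℤP.*-distribˡ-+ (+ (i C j)) (b j) (b (suc j)))) ⟩
    sumℤ i (λ j → + (i C j) * (b j + b (suc j))) ∎
    where
    open ≡-Reasoning
    pascal-term : ∀ j → + (suc i C suc j) * b (suc j) ≡ + (i C suc j) * b (suc j) + + (i C j) * b (suc j)
    pascal-term j = begin
      + (suc i C suc j) * b (suc j)
        ≡⟨ cong (λ c → + c * b (suc j)) (sym (nCk+nC[k+1]≡[n+1]C[k+1] i j)) ⟩
      + (i C j ℕ.+ i C suc j) * b (suc j)
        ≡⟨ cong (_* b (suc j)) (trans (ℤP.pos-+ (i C j) (i C suc j)) (ℤP.+-comm (+ (i C j)) (+ (i C suc j)))) ⟩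
      (+ (i C suc j) + + (i C j)) * b (suc j)
        ≡⟨ ℤP.*-distribʳ-+ (b (suc j)) (+ (i C suc j)) (+ (i C j)) ⟩
      + (i C suc j) * b (suc j) + + (i C j) * b (suc j) ∎
    top-term-vanishes : sumℤ (suc i) (λ j → + (i C j) * b j) ≡ sumℤ i (λ j → + (i C j) * b j)
    top-term-vanishes =
      trans (cong (λ c → sumℤ i (λ j → + (i C j) * b j) + + c * b (suc i)) (n<k⇒nCk≡0 (ℕP.n<1+n i)))
            (ℤP.+-identityʳ _)

module InnerSum (k′ : ℕ) where

  open SumProperties
  open Binomial using (sumℤ-pascal)
  open import Data.Nat as ℕ using (ℕ; suc)
  import Data.Nat.Properties as ℕP
  open import Data.Nat.Combinatorics using (_C_)
  open import Data.Integer using (ℤ; +_; 1ℤ; _+_; _*_; -_; _-_; _^_)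
  import Data.Integer.Properties as ℤP
  open import Data.Integer.Tactic.RingSolver using (solve-∀)
  open import Relation.Binary.PropositionalEquality

  k : ℕ
  k = suc k′

  open NegativeGeometricPowers k public

  -- Defs.innerSum k n i is innerSumℤ (+ n) i; the recurrence needs negative first arguments too.
  innerSumℤ : ℤ → ℕ → ℤ
  innerSumℤ y i = sumℤ i (λ j → (- 1ℤ) ^ j * + (i C j) * W j (y - + i - + (k ℕ.* j)))

  module _ (y : ℤ) (i : ℕ) where

    open ≡-Reasoning

    private
      σ : ℕ → ℤ
      σ j = (- 1ℤ) ^ j
      c : ℕ → ℤ
      c j = + (i C j)
      H : ℕ → ℕ → ℤ
      H j l = W j (y - + l - + suc i - + (k ℕ.* j))
      z : ℕ → ℤ
      z j = y - + suc i - + (k ℕ.* suc j)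

      reassoc : ∀ s c w → s * c * w ≡ c * (s * w)
      reassoc = solve-∀

      shift-arg : ∀ l j → y - + suc l - + i - + (k ℕ.* j) ≡ y - + l - + suc i - + (k ℕ.* j)
      shift-arg l j =
        trans (cong (λ a → y - a - + i - + (k ℕ.* j)) (ℤP.pos-+ 1 l))
              (trans (swap y (+ l) (+ i) (+ (k ℕ.* j)))
                     (cong (λ t → y - + l - t - + (k ℕ.* j)) (sym (ℤP.pos-+ 1 i))))
        where
        swap : ∀ y l i m → y - (1ℤ + l) - i - m ≡ y - l - (1ℤ + i) - m
        swap = solve-∀

      sum-H-suc : ∀ j → sumℤ k (H (suc j)) ≡ W j (z j)
      sum-H-suc j = trans (sumℤ-cong k (λ l → cong (W (suc j)) (move y (+ l) (+ suc i) (+ (k ℕ.* suc j)))))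
                          (W-rec j (z j))
        where
        move : ∀ y l a b → y - l - a - b ≡ y - a - b - l
        move = solve-∀

      H-last : ∀ j → H j k ≡ W j (z j)
      H-last j = cong (W j) (trans (move y (+ k) (+ suc i) (+ (k ℕ.* j)))
                                   (cong (λ t → y - + suc i - t)
                                         (trans (sym (ℤP.pos-+ k (k ℕ.* j))) (cong +_ (sym (ℕP.*-suc k j))))))
        where
        move : ∀ y K a m → y - K - a - m ≡ y - a - (K + m)
        move = solve-∀

      -- σ (suc j) = - σ j, and the last term of Σ_{l ≤ k} H j cancels against Σ_{l ≤ k} H (suc j)
      collapse : ∀ j → sumℤ k (λ l → c j * (σ j * H j l + σ (suc j) * H (suc j) l)) ≡
                       sumℤ k′ (λ l → c j * (σ j * H j l))
      collapse j = begin
        sumℤ k (λ l → c j * (σ j * H j l + σ (suc j) * H (suc j) l))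
          ≡⟨ sym (*-distribˡ-sumℤ k (c j) _) ⟩
        c j * sumℤ k (λ l → σ j * H j l + σ (suc j) * H (suc j) l)
          ≡⟨ cong (c j *_) (trans (sumℤ-distrib-+ k _ _)
                                  (cong₂ _+_ (sym (*-distribˡ-sumℤ k (σ j) (H j)))
                                             (sym (*-distribˡ-sumℤ k (σ (suc j)) (H (suc j)))))) ⟩
        c j * (σ j * (sumℤ k′ (H j) + H j k) + σ (suc j) * sumℤ k (H (suc j)))
          ≡⟨ cong₂ (λ a b → c j * (σ j * (sumℤ k′ (H j) + a) + σ (suc j) * b)) (H-last j) (sum-H-suc j) ⟩
        c j * (σ j * (sumℤ k′ (H j) + W j (z j)) + - 1ℤ * σ j * W j (z j))
          ≡⟨ cancel (c j) (σ j) (sumℤ k′ (H j)) (W j (z j)) ⟩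
        c j * (σ j * sumℤ k′ (H j))
          ≡⟨ cong (c j *_) (*-distribˡ-sumℤ k′ (σ j) (H j)) ⟩
        c j * sumℤ k′ (λ l → σ j * H j l)
          ≡⟨ *-distribˡ-sumℤ k′ (c j) _ ⟩
        sumℤ k′ (λ l → c j * (σ j * H j l)) ∎
        where
        cancel : ∀ c s h w → c * (s * (h + w) + - 1ℤ * s * w) ≡ c * (s * h)
        cancel = solve-∀

    innerSumℤ-rec : sumℤ k (λ l → innerSumℤ (y - + l) (suc i)) ≡ sumℤ k′ (λ l → innerSumℤ (y - + suc l) i)
    innerSumℤ-rec = begin
      sumℤ k (λ l → innerSumℤ (y - + l) (suc i))
        ≡⟨ sumℤ-cong k (λ l → trans (sumℤ-cong (suc i) (λ j → reassoc (σ j) _ (H j l)))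
                                    (sumℤ-pascal i (λ j → σ j * H j l))) ⟩
      sumℤ k (λ l → sumℤ i (λ j → c j * (σ j * H j l + σ (suc j) * H (suc j) l)))
        ≡⟨ sumℤ-comm k i _ ⟩
      sumℤ i (λ j → sumℤ k (λ l → c j * (σ j * H j l + σ (suc j) * H (suc j) l)))
        ≡⟨ sumℤ-cong i collapse ⟩
      sumℤ i (λ j → sumℤ k′ (λ l → c j * (σ j * H j l)))
        ≡⟨ sumℤ-comm i k′ _ ⟩
      sumℤ k′ (λ l → sumℤ i (λ j → c j * (σ j * H j l)))
        ≡⟨ sumℤ-cong k′ (λ l → sumℤ-cong i (λ j →
             trans (sym (reassoc (σ j) (c j) (H j l))) (cong (λ t → σ j * c j * W j t) (sym (shift-arg l j))))) ⟩
      sumℤ k′ (λ l → innerSumℤ (y - + suc l) i) ∎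

module BallotNumbers where

  open Binomial using (n<k⇒nCk≡0)
  open import Data.Nat using (ℕ; zero; suc; _+_; _*_; _∸_; _≤_; z≤n; s≤s)
  import Data.Nat.Properties as ℕP
  open import Data.Nat.Combinatorics using (_C_; nCk+nC[k+1]≡[n+1]C[k+1]; nCk≡nC[n∸k]; nC1≡n)
  open import Data.Nat.Tactic.RingSolver using (solve-∀)
  open import Relation.Binary.PropositionalEquality

  -- paths from height 0 to height d with i down-steps that never go below 0, split by their last step
  ballotNumber : ℕ → ℕ → ℕ
  ballotNumber d       zero    = 1
  ballotNumber zero    (suc i) = ballotNumber 1 i
  ballotNumber (suc d) (suc i) = ballotNumber d (suc i) + ballotNumber (suc (suc d)) i

  private
    pascal : ∀ n k → suc n C suc k ≡ n C k + n C suc k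
    pascal n k = sym (nCk+nC[k+1]≡[n+1]C[k+1] n k)

  [1+k]*[1+n]C[1+k]≡[1+n]*nCk : ∀ n k → suc k * (suc n C suc k) ≡ suc n * (n C k)
  [1+k]*[1+n]C[1+k]≡[1+n]*nCk zero zero = refl
  [1+k]*[1+n]C[1+k]≡[1+n]*nCk zero (suc k) =
    trans (cong (suc (suc k) *_) (n<k⇒nCk≡0 {1} {suc (suc k)} (s≤s (s≤s z≤n))))
          (trans (ℕP.*-zeroʳ (suc (suc k))) (sym (cong (1 *_) (n<k⇒nCk≡0 {0} {suc k} (s≤s z≤n)))))
  [1+k]*[1+n]C[1+k]≡[1+n]*nCk (suc n) zero =
    trans (cong (1 *_) (pascal (suc n) 0))
          (trans (cong (λ t → 1 * (1 + t)) (trans (sym (ℕP.*-identityˡ _)) ([1+k]*[1+n]C[1+k]≡[1+n]*nCk n 0)))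
                 (tidy n))
    where
    tidy : ∀ n → 1 * (1 + suc n * 1) ≡ suc (suc n) * 1
    tidy = solve-∀
  [1+k]*[1+n]C[1+k]≡[1+n]*nCk (suc n) (suc k) = begin
    suc (suc k) * (suc (suc n) C suc (suc k))     ≡⟨ cong (suc (suc k) *_) (pascal (suc n) (suc k)) ⟩
    suc (suc k) * (X + Y)                         ≡⟨ expand k X Y ⟩
    suc k * X + X + suc (suc k) * Y               ≡⟨ cong₂ (λ a b → a + X + b) ([1+k]*[1+n]C[1+k]≡[1+n]*nCk n k)
                                                                              ([1+k]*[1+n]C[1+k]≡[1+n]*nCk n (suc k)) ⟩
    suc n * (n C k) + X + suc n * (n C suc k)     ≡⟨ collect n (n C k) X (n C suc k) ⟩
    suc n * (n C k + n C suc k) + X               ≡⟨ cong (λ t → suc n * t + X) (sym (pascal n k)) ⟩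
    suc n * X + X                                 ≡⟨ finish n X ⟩
    suc (suc n) * X                               ∎
    where
    open ≡-Reasoning
    X : ℕ
    X = suc n C suc k
    Y : ℕ
    Y = suc n C suc (suc k)
    expand : ∀ k X Y → suc (suc k) * (X + Y) ≡ suc k * X + X + suc (suc k) * Y
    expand = solve-∀
    collect : ∀ n a X b → suc n * a + X + suc n * b ≡ suc n * (a + b) + X
    collect = solve-∀
    finish : ∀ n X → suc n * X + X ≡ suc (suc n) * X
    finish = solve-∀

  [1+k]*[m+1+k]C[1+k]≡[1+m]*[m+1+k]Ck : ∀ m k → suc k * ((m + suc k) C suc k) ≡ suc m * ((m + suc k) C k)
  [1+k]*[m+1+k]C[1+k]≡[1+m]*[m+1+k]Ck m zero =
    trans (ℕP.*-identityˡ _) (trans (nC1≡n (m + 1)) (trans (ℕP.+-comm m 1) (sym (ℕP.*-identityʳ (suc m)))))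
  [1+k]*[m+1+k]C[1+k]≡[1+m]*[m+1+k]Ck m (suc k) = ℕP.*-cancelˡ-≡ _ _ (suc k) (begin
    suc k * (suc (suc k) * (N C suc (suc k)))   ≡⟨ cong (λ t → suc k * (suc (suc k) * (t C suc (suc k)))) N≡1+n ⟩
    suc k * (suc (suc k) * (suc n C suc (suc k))) ≡⟨ cong (suc k *_) ([1+k]*[1+n]C[1+k]≡[1+n]*nCk n (suc k)) ⟩
    suc k * (suc n * (n C suc k))               ≡⟨ swap (suc k) (suc n) (n C suc k) ⟩
    suc n * (suc k * (n C suc k))               ≡⟨ cong (suc n *_) ([1+k]*[m+1+k]C[1+k]≡[1+m]*[m+1+k]Ck m k) ⟩
    suc n * (suc m * (n C k))                   ≡⟨ swap (suc n) (suc m) (n C k) ⟩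
    suc m * (suc n * (n C k))                   ≡⟨ cong (suc m *_) (sym ([1+k]*[1+n]C[1+k]≡[1+n]*nCk n k)) ⟩
    suc m * (suc k * (suc n C suc k))           ≡⟨ swap (suc m) (suc k) _ ⟩
    suc k * (suc m * (suc n C suc k))           ≡⟨ cong (λ t → suc k * (suc m * (t C suc k))) (sym N≡1+n) ⟩
    suc k * (suc m * (N C suc k))               ∎)
    where
    open ≡-Reasoning
    n : ℕ
    n = m + suc k
    N : ℕ
    N = m + suc (suc k)
    N≡1+n : N ≡ suc n
    N≡1+n = ℕP.+-suc m (suc k)
    swap : ∀ a b c → a * (b * c) ≡ b * (a * c)
    swap = solve-∀

  ballotNumber+C≡C : ∀ d j N → N ≡ d + 2 * suc j → ballotNumber d (suc j) + N C j ≡ N C suc j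
  ballotNumber+C≡C zero    zero    .(0 + 2 * 1) refl = refl
  ballotNumber+C≡C zero    (suc j) N N≡ =
    subst (λ t → ballotNumber 0 (suc (suc j)) + t C suc j ≡ t C suc (suc j)) (sym (trans N≡ (N≡1+M j))) (begin
      ballotNumber 1 (suc j) + suc M C suc j              ≡⟨ cong (ballotNumber 1 (suc j) +_) (pascal M j) ⟩
      ballotNumber 1 (suc j) + (M C j + M C suc j)        ≡⟨ sym (ℕP.+-assoc (ballotNumber 1 (suc j)) (M C j) _) ⟩
      ballotNumber 1 (suc j) + M C j + M C suc j          ≡⟨ cong (_+ M C suc j) (ballotNumber+C≡C 1 j M refl) ⟩
      M C suc j + M C suc j                               ≡⟨ cong (M C suc j +_) (sym symmetric) ⟩
      M C suc j + M C suc (suc j)                         ≡⟨ sym (pascal M (suc j)) ⟩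
      suc M C suc (suc j)                                 ∎)
    where
    open ≡-Reasoning
    M : ℕ
    M = 1 + 2 * suc j
    N≡1+M : ∀ j → 0 + 2 * suc (suc j) ≡ suc (1 + 2 * suc j)
    N≡1+M = solve-∀
    M≡ : M ≡ suc (suc j) + suc j
    M≡ = split j
      where
      split : ∀ j → 1 + 2 * suc j ≡ suc (suc j) + suc j
      split = solve-∀
    symmetric : M C suc (suc j) ≡ M C suc j
    symmetric = trans (nCk≡nC[n∸k] (subst (suc (suc j) ≤_) (sym M≡) (ℕP.m≤m+n (suc (suc j)) (suc j))))
                      (cong (M C_) (trans (cong (_∸ suc (suc j)) M≡) (ℕP.m+n∸m≡n (suc (suc j)) (suc j))))
  ballotNumber+C≡C (suc d) zero    .(suc d + 2 * 1) refl =
    trans (cong (_+ 1) (ballotNumber+C≡C d 0 (d + 2 * 1) refl))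
          (trans (ℕP.+-comm _ 1) (sym (pascal (d + 2 * 1) 0)))
  ballotNumber+C≡C (suc d) (suc j) .(suc d + 2 * suc (suc j)) refl = begin
    (B₁ + B₂) + suc N₀ C suc j                ≡⟨ cong ((B₁ + B₂) +_) (pascal N₀ j) ⟩
    (B₁ + B₂) + (N₀ C j + N₀ C suc j)         ≡⟨ regroup B₁ B₂ (N₀ C j) (N₀ C suc j) ⟩
    B₁ + (B₂ + N₀ C j) + N₀ C suc j           ≡⟨ cong (λ t → B₁ + t + N₀ C suc j)
                                                      (ballotNumber+C≡C (suc (suc d)) j N₀ (N₀≡ d j)) ⟩
    B₁ + N₀ C suc j + N₀ C suc j              ≡⟨ cong (_+ N₀ C suc j) (ballotNumber+C≡C d (suc j) N₀ refl) ⟩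
    N₀ C suc (suc j) + N₀ C suc j             ≡⟨ ℕP.+-comm _ (N₀ C suc j) ⟩
    N₀ C suc j + N₀ C suc (suc j)             ≡⟨ sym (pascal N₀ (suc j)) ⟩
    suc N₀ C suc (suc j)                      ∎
    where
    open ≡-Reasoning
    N₀ : ℕ
    N₀ = d + 2 * suc (suc j)
    B₁ : ℕ
    B₁ = ballotNumber d (suc (suc j))
    B₂ : ℕ
    B₂ = ballotNumber (suc (suc d)) (suc j)
    regroup : ∀ a b c e → (a + b) + (c + e) ≡ a + (b + c) + e
    regroup = solve-∀
    N₀≡ : ∀ d j → d + 2 * suc (suc j) ≡ suc (suc d) + 2 * suc j
    N₀≡ = solve-∀

  ballotNumber-closedForm : ∀ d i → suc d * ((d + 2 * i) C i) ≡ suc (d + i) * ballotNumber d i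
  ballotNumber-closedForm d zero    = tidy d
    where
    tidy : ∀ d → suc d * 1 ≡ suc (d + 0) * 1
    tidy = solve-∀
  ballotNumber-closedForm d (suc j) = ℕP.+-cancelʳ-≡ (suc j * Z) (suc d * Z) (s * X) (begin
    suc d * Z + suc j * Z    ≡⟨ sym (ℕP.*-distribʳ-+ Z (suc d) (suc j)) ⟩
    s * Z                    ≡⟨ cong (s *_) (sym (ballotNumber+C≡C d j N refl)) ⟩
    s * (X + Y)              ≡⟨ ℕP.*-distribˡ-+ s X Y ⟩
    s * X + s * Y            ≡⟨ cong (s * X +_) (sym ratio) ⟩
    s * X + suc j * Z        ∎)
    where
    open ≡-Reasoning
    N : ℕ
    N = d + 2 * suc j
    Z : ℕ
    Z = N C suc j
    Y : ℕ
    Y = N C j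
    X : ℕ
    X = ballotNumber d (suc j)
    s : ℕ
    s = suc (d + suc j)
    N≡ : ∀ d j → d + 2 * suc j ≡ (d + suc j) + suc j
    N≡ = solve-∀
    ratio : suc j * Z ≡ s * Y
    ratio = subst (λ t → suc j * (t C suc j) ≡ s * (t C j)) (sym (N≡ d j))
                  ([1+k]*[m+1+k]C[1+k]≡[1+m]*[m+1+k]Ck (d + suc j) j)

module Recurrence where

  open import Data.Nat as ℕ using (ℕ; zero; suc; _≤_; _<_; _<?_; s≤s)
  import Data.Nat.Properties as ℕP
  open import Data.Integer using (ℤ; 1ℤ; _+_; _-_)
  open import Data.Integer.Tactic.RingSolver using (solve-∀)
  open import Data.Product using (_,_)
  open import Relation.Binary.PropositionalEquality
  open import Relation.Nullary using (yes; no)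

  -- S n d stands for s_n(n + d); shiftDown S n d is s_n(n + d - 1), where s_n(n - 1) = [n = 0]
  -- accounts for the empty path.
  shiftDown : (ℕ → ℕ → ℤ) → ℕ → ℕ → ℤ
  shiftDown S n zero    = δ0 n
  shiftDown S n (suc d) = S n d

  Δ : (ℕ → ℕ → ℤ) → ℕ → ℕ → ℤ
  Δ S n d = S n d - shiftDown S n d

  record SatisfiesRecurrence (k : ℕ) (S : ℕ → ℕ → ℤ) : Set where
    field
      base    : ∀ d → S 0 d ≡ 1ℤ
      Δ-below : ∀ n d → n < k → Δ S (suc n) d ≡ S n (suc d)
      Δ-above : ∀ n d → Δ S (suc (k ℕ.+ n)) d - Δ S n d ≡ S (k ℕ.+ n) (suc d) - S n (suc d)

  module _ {k : ℕ} {S S′ : ℕ → ℕ → ℤ} (R : SatisfiesRecurrence k S) (R′ : SatisfiesRecurrence k S′) where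

    private
      module R  = SatisfiesRecurrence R
      module R′ = SatisfiesRecurrence R′

      split-Δ : ∀ a b → a ≡ b + (a - b)
      split-Δ = solve-∀

      solve-Δ : ∀ a b c → a - b ≡ c → a ≡ b + c
      solve-Δ a b c refl = split-Δ a b

      shiftDown-cong : ∀ n d → (∀ e → e < d → S n e ≡ S′ n e) → shiftDown S n d ≡ shiftDown S′ n d
      shiftDown-cong n zero    _  = refl
      shiftDown-cong n (suc d) eq = eq d ℕP.≤-refl

      Δ-cong : ∀ n d → (∀ e → e ≤ d → S n e ≡ S′ n e) → Δ S n d ≡ Δ S′ n d
      Δ-cong n d eq = cong₂ _-_ (eq d ℕP.≤-refl) (shiftDown-cong n d (λ e e<d → eq e (ℕP.<⇒≤ e<d)))

      Δ-suc-cong : ∀ m d → (∀ x → x ≤ m → ∀ e → S x e ≡ S′ x e) → Δ S (suc m) d ≡ Δ S′ (suc m) d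
      Δ-suc-cong m d ih with m <? k
      ... | yes m<k = trans (R.Δ-below m d m<k) (trans (ih m ℕP.≤-refl (suc d)) (sym (R′.Δ-below m d m<k)))
      ... | no  m≮k with ℕP.m≤n⇒∃[o]m+o≡n (ℕP.≮⇒≥ m≮k)
      ...   | n , refl =
        trans (solve-Δ _ _ _ (R.Δ-above n d))
              (trans (cong₂ _+_ (Δ-cong n d (λ e _ → ih n n≤m e))
                                (cong₂ _-_ (ih (k ℕ.+ n) ℕP.≤-refl (suc d)) (ih n n≤m (suc d))))
                     (sym (solve-Δ _ _ _ (R′.Δ-above n d))))
        where
        n≤m : n ≤ k ℕ.+ n
        n≤m = ℕP.m≤n+m n k

    recurrence-unique : ∀ n d → S n d ≡ S′ n d
    recurrence-unique n = bounded n n ℕP.≤-refl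
      where
      bounded : ∀ M n → n ≤ M → ∀ d → S n d ≡ S′ n d
      bounded M       zero    _       d = trans (R.base d) (sym (R′.base d))
      bounded (suc M) (suc m) (s≤s m≤M) = column
        where
        column : ∀ d → S (suc m) d ≡ S′ (suc m) d
        lower : ∀ d → shiftDown S (suc m) d ≡ shiftDown S′ (suc m) d
        column d = trans (split-Δ (S (suc m) d) (shiftDown S (suc m) d))
                         (trans (cong₂ _+_ (lower d)
                                           (Δ-suc-cong m d (λ x x≤m → bounded M x (ℕP.≤-trans x≤m m≤M))))
                                (sym (split-Δ (S′ (suc m) d) (shiftDown S′ (suc m) d))))
        lower zero    = refl
        lower (suc d) = column d

module FormulaRecurrence (k′ : ℕ) where

  open SumProperties
  open Recurrence
  open BallotNumbers
  open IntegerSubtraction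
  open InnerSum k′
  open import Data.Nat as ℕ using (ℕ; zero; suc; _≤_; _<_)
  import Data.Nat.Properties as ℕP
  open import Data.Nat.Combinatorics using (_C_)
  open import Data.Integer using (ℤ; +_; 0ℤ; 1ℤ; _+_; _*_; -_; _-_; _^_) renaming (_<_ to _<ℤ_)
  import Data.Integer.Properties as ℤP
  open import Data.Integer.Tactic.RingSolver using (solve-∀)
  open import Function using (_∘_)
  open import Relation.Binary.PropositionalEquality

  private
    *-vanishʳ : ∀ a {b} → b ≡ 0ℤ → a * b ≡ 0ℤ
    *-vanishʳ a refl = ℤP.*-zeroʳ a

    *-vanishˡ : ∀ {a} b → a ≡ 0ℤ → a * b ≡ 0ℤ
    *-vanishˡ b refl = ℤP.*-zeroˡ b

  innerSumℤ-negative : ∀ {y} i → y <ℤ 0ℤ → innerSumℤ y i ≡ 0ℤ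
  innerSumℤ-negative {y} i y<0 = sumℤ-zero i (λ j _ →
    *-vanishʳ ((- 1ℤ) ^ j * + (i C j)) (W-negative j (i<0⇒i-+n<0 (k ℕ.* j) (i<0⇒i-+n<0 i y<0))))

  innerSumℤ-beyond : ∀ {x i} → x < i → innerSumℤ (+ x) i ≡ 0ℤ
  innerSumℤ-beyond {x} {i} x<i = sumℤ-zero i (λ j _ →
    *-vanishʳ ((- 1ℤ) ^ j * + (i C j)) (W-negative j (i<0⇒i-+n<0 (k ℕ.* j) (+m-+n<0 x<i))))

  innerSumℤ-0 : ∀ x → innerSumℤ (+ x) 0 ≡ δ0 x
  innerSumℤ-0 x = trans (ℤP.*-identityˡ _)
    (cong (W 0) (trans (cong (λ t → + x - + 0 - + t) (ℕP.*-zeroʳ k))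
                       (trans (ℤP.+-identityʳ _) (ℤP.+-identityʳ _))))

  ballotSum : ℕ → ℤ → ℕ → ℤ
  ballotSum B y d = sumℤ B (λ i → innerSumℤ y i * + ballotNumber d i)

  F : ℕ → ℕ → ℤ
  F n = ballotSum n (+ n)

  ballotSum-extend : ∀ {B x} d → x ≤ B → ballotSum B (+ x) d ≡ F x d
  ballotSum-extend d x≤B =
    sumℤ-extend x≤B (λ i x<i _ → *-vanishˡ (+ ballotNumber d i) (innerSumℤ-beyond x<i))

  ballotSumΔ : ℕ → ℕ → ℤ → ℤ
  ballotSumΔ B d y = sumℤ B (λ i → innerSumℤ y (suc i) * + ballotNumber (suc d) i)

  ballotSumΔ-negative : ∀ B d {y} → y <ℤ 0ℤ → ballotSumΔ B d y ≡ 0ℤ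
  ballotSumΔ-negative B d y<0 =
    sumℤ-zero B (λ i _ → *-vanishˡ (+ ballotNumber (suc d) i) (innerSumℤ-negative (suc i) y<0))

  ballotSumΔ-Δ : ∀ B x d → ballotSumΔ B d (+ x) ≡ Δ (λ n → ballotSum (suc B) (+ n)) x d
  ballotSumΔ-Δ B x zero = sym (begin
    ballotSum (suc B) (+ x) 0 - δ0 x
      ≡⟨ cong₂ _-_ (sumℤ-suc B _) (sym (innerSumℤ-0 x)) ⟩
    innerSumℤ (+ x) 0 * 1ℤ + ballotSumΔ B 0 (+ x) - innerSumℤ (+ x) 0
      ≡⟨ cancel (innerSumℤ (+ x) 0) _ ⟩
    ballotSumΔ B 0 (+ x) ∎)
    where
    open ≡-Reasoning
    cancel : ∀ c D → c * 1ℤ + D - c ≡ D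
    cancel = solve-∀
  ballotSumΔ-Δ B x (suc d) = sym (begin
    ballotSum (suc B) (+ x) (suc d) - ballotSum (suc B) (+ x) d
      ≡⟨ sym (sumℤ-distrib-minus (suc B) _ _) ⟩
    sumℤ (suc B) (λ i → c i * + ballotNumber (suc d) i - c i * + ballotNumber d i)
      ≡⟨ sumℤ-suc B _ ⟩
    c 0 * 1ℤ - c 0 * 1ℤ + sumℤ B (λ i → c (suc i) * + ballotNumber (suc d) (suc i)
                                      - c (suc i) * + ballotNumber d (suc i))
      ≡⟨ cancel (c 0) _ ⟩
    sumℤ B (λ i → c (suc i) * + ballotNumber (suc d) (suc i) - c (suc i) * + ballotNumber d (suc i))
      ≡⟨ sumℤ-cong B (λ i → trans (cong (λ t → c (suc i) * t - c (suc i) * + ballotNumber d (suc i))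
                                        (ℤP.pos-+ (ballotNumber d (suc i)) (ballotNumber (suc (suc d)) i)))
                                  (difference (c (suc i)) _ _)) ⟩
    ballotSumΔ B (suc d) (+ x) ∎)
    where
    open ≡-Reasoning
    c : ℕ → ℤ
    c = innerSumℤ (+ x)
    cancel : ∀ c D → c * 1ℤ - c * 1ℤ + D ≡ D
    cancel = solve-∀
    difference : ∀ c a b → c * (a + b) - c * a ≡ c * b
    difference = solve-∀

  Δ-ballotSum-extend : ∀ B {x} d → x ≤ suc B → Δ (λ n → ballotSum (suc B) (+ n)) x d ≡ Δ F x d
  Δ-ballotSum-extend B zero    x≤ = cong (_- _) (ballotSum-extend 0 x≤)
  Δ-ballotSum-extend B (suc d) x≤ = cong₂ _-_ (ballotSum-extend (suc d) x≤) (ballotSum-extend d x≤)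

  ballotSumΔ-rec : ∀ B d y → sumℤ k (λ l → ballotSumΔ B d (y - + l)) ≡
                             sumℤ k′ (λ l → ballotSum B (y - + suc l) (suc d))
  ballotSumΔ-rec B d y = begin
    sumℤ k (λ l → sumℤ B (λ i → innerSumℤ (y - + l) (suc i) * b i))
      ≡⟨ sumℤ-comm k B _ ⟩
    sumℤ B (λ i → sumℤ k (λ l → innerSumℤ (y - + l) (suc i) * b i))
      ≡⟨ sumℤ-cong B (λ i → sym (*-distribʳ-sumℤ k (b i) (λ l → innerSumℤ (y - + l) (suc i)))) ⟩
    sumℤ B (λ i → sumℤ k (λ l → innerSumℤ (y - + l) (suc i)) * b i)
      ≡⟨ sumℤ-cong B (λ i → cong (_* b i) (innerSumℤ-rec y i)) ⟩
    sumℤ B (λ i → sumℤ k′ (λ l → innerSumℤ (y - + suc l) i) * b i)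
      ≡⟨ sumℤ-cong B (λ i → *-distribʳ-sumℤ k′ (b i) (λ l → innerSumℤ (y - + suc l) i)) ⟩
    sumℤ B (λ i → sumℤ k′ (λ l → innerSumℤ (y - + suc l) i * b i))
      ≡⟨ sumℤ-comm B k′ _ ⟩
    sumℤ k′ (λ l → sumℤ B (λ i → innerSumℤ (y - + suc l) i * b i)) ∎
    where
    open ≡-Reasoning
    b : ℕ → ℤ
    b i = + ballotNumber (suc d) i

  +[1+m]-+[1+n] : ∀ m n → + suc m - + suc n ≡ + m - + n
  +[1+m]-+[1+n] m n =
    trans (cong₂ _-_ (ℤP.pos-+ 1 m) (ℤP.pos-+ 1 n)) (cancel (+ m) (+ n))
    where
    cancel : ∀ m n → (1ℤ + m) - (1ℤ + n) ≡ m - n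
    cancel = solve-∀

  -- ballotSumΔ-rec at y = x + 1 minus ballotSumΔ-rec at y = x; both sides telescope
  ballotSumΔ-window : ∀ B d x → ballotSumΔ B d (+ suc x) - ballotSumΔ B d (+ x - + k) ≡
                                ballotSum B (+ x) (suc d) - ballotSum B (+ x - + k) (suc d)
  ballotSumΔ-window B d x = begin
    ballotSumΔ B d (+ suc x) - ballotSumΔ B d (+ x - + k)
      ≡⟨ cong₂ (λ s t → ballotSumΔ B d s - ballotSumΔ B d t)
               (sym (ℤP.+-identityʳ (+ suc x))) (sym (+[1+m]-+[1+n] x k)) ⟩
    a 0 - a (suc k)
      ≡⟨ sym (sumℤ-telescope k a) ⟩
    sumℤ k a - sumℤ k (a ∘ suc)
      ≡⟨ cong (_-_ (sumℤ k a)) (sumℤ-cong k (λ l → cong (ballotSumΔ B d) (+[1+m]-+[1+n] x l))) ⟩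
    sumℤ k a - sumℤ k (λ l → ballotSumΔ B d (+ x - + l))
      ≡⟨ cong₂ _-_ (ballotSumΔ-rec B d (+ suc x)) (ballotSumΔ-rec B d (+ x)) ⟩
    sumℤ k′ (λ l → ballotSum B (+ suc x - + suc l) (suc d)) - sumℤ k′ (b ∘ suc)
      ≡⟨ cong (_- sumℤ k′ (b ∘ suc))
              (sumℤ-cong k′ (λ l → cong (λ t → ballotSum B t (suc d)) (+[1+m]-+[1+n] x l))) ⟩
    sumℤ k′ b - sumℤ k′ (b ∘ suc)
      ≡⟨ sumℤ-telescope k′ b ⟩
    b 0 - b k
      ≡⟨ cong (λ s → ballotSum B s (suc d) - b k) (ℤP.+-identityʳ (+ x)) ⟩
    ballotSum B (+ x) (suc d) - ballotSum B (+ x - + k) (suc d) ∎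
    where
    open ≡-Reasoning
    a : ℕ → ℤ
    a l = ballotSumΔ B d (+ suc x - + l)
    b : ℕ → ℤ
    b l = ballotSum B (+ x - + l) (suc d)

  Δ-F : ∀ B n d → n ≤ suc B → ballotSumΔ B d (+ n) ≡ Δ F n d
  Δ-F B n d n≤ = trans (ballotSumΔ-Δ B n d) (Δ-ballotSum-extend B d n≤)

  F-satisfiesRecurrence : SatisfiesRecurrence k F
  F-satisfiesRecurrence = record
    { base    = λ d → cong (_* 1ℤ) (innerSumℤ-0 0)
    ; Δ-below = Δ-below
    ; Δ-above = Δ-above
    }
    where
    drop-zero : ∀ a b → b ≡ 0ℤ → a - b ≡ a
    drop-zero a b refl = ℤP.+-identityʳ a

    Δ-below : ∀ n d → n < k → Δ F (suc n) d ≡ F n (suc d)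
    Δ-below n d n<k = begin
      Δ F (suc n) d
        ≡⟨ sym (Δ-F n (suc n) d ℕP.≤-refl) ⟩
      ballotSumΔ n d (+ suc n)
        ≡⟨ sym (drop-zero _ _ (ballotSumΔ-negative n d (+m-+n<0 n<k))) ⟩
      ballotSumΔ n d (+ suc n) - ballotSumΔ n d (+ n - + k)
        ≡⟨ ballotSumΔ-window n d n ⟩
      F n (suc d) - ballotSum n (+ n - + k) (suc d)
        ≡⟨ drop-zero _ _ (sumℤ-zero n (λ i _ →
             *-vanishˡ (+ ballotNumber (suc d) i) (innerSumℤ-negative i (+m-+n<0 n<k)))) ⟩
      F n (suc d) ∎
      where open ≡-Reasoning

    Δ-above : ∀ n d → Δ F (suc (k ℕ.+ n)) d - Δ F n d ≡ F (k ℕ.+ n) (suc d) - F n (suc d)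
    Δ-above n d = begin
      Δ F (suc x) d - Δ F n d
        ≡⟨ sym (cong₂ _-_ (Δ-F x (suc x) d ℕP.≤-refl) (Δ-F x n d (ℕP.m≤n⇒m≤1+n n≤x))) ⟩
      ballotSumΔ x d (+ suc x) - ballotSumΔ x d (+ n)
        ≡⟨ cong (λ t → ballotSumΔ x d (+ suc x) - ballotSumΔ x d t) (sym x-k≡n) ⟩
      ballotSumΔ x d (+ suc x) - ballotSumΔ x d (+ x - + k)
        ≡⟨ ballotSumΔ-window x d x ⟩
      F x (suc d) - ballotSum x (+ x - + k) (suc d)
        ≡⟨ cong (λ t → F x (suc d) - ballotSum x t (suc d)) x-k≡n ⟩
      F x (suc d) - ballotSum x (+ n) (suc d)
        ≡⟨ cong (_-_ (F x (suc d))) (ballotSum-extend (suc d) n≤x) ⟩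
      F x (suc d) - F n (suc d) ∎
      where
      open ≡-Reasoning
      x : ℕ
      x = k ℕ.+ n
      n≤x : n ≤ x
      n≤x = ℕP.m≤n+m n k
      x-k≡n : + x - + k ≡ + n
      x-k≡n = trans (+m-+n≡+[m∸n] (ℕP.m≤m+n k n)) (cong +_ (ℕP.m+n∸m≡n k n))

module Counting where

  open import Data.Nat using (ℕ; zero; suc; _+_)
  import Data.Nat.Properties as ℕP
  open import Data.Nat.Tactic.RingSolver using (solve-∀)
  open import Data.Bool using (Bool; true; false; _∧_; not; if_then_else_)
  import Data.Bool.Properties as BP
  open import Data.List using (List; []; _∷_; _++_; length; filter; reverse; _∷ʳ_; concatMap)
  import Data.List.Properties as LP
  open import Data.List.Relation.Binary.Prefix.Heterogeneous.Properties using (prefix?)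
  open import Function using (_∘_)
  open import Relation.Binary.PropositionalEquality
  open import Relation.Nullary using (does)
  open import Relation.Unary using (Decidable)

  count : ℕ → (Path → Bool) → ℕ
  count zero    P = if P [] then 1 else 0
  count (suc L) P = count L (P ∘ (u ∷_)) + count L (P ∘ (r ∷_))

  count-cong : ∀ L {P Q : Path → Bool} → (∀ w → P w ≡ Q w) → count L P ≡ count L Q
  count-cong zero    P≗Q rewrite P≗Q [] = refl
  count-cong (suc L) P≗Q = cong₂ _+_ (count-cong L (P≗Q ∘ (u ∷_))) (count-cong L (P≗Q ∘ (r ∷_)))

  count-false : ∀ L {P : Path → Bool} → (∀ w → P w ≡ false) → count L P ≡ 0
  count-false zero    P≗false rewrite P≗false [] = refl
  count-false (suc L) P≗false
    rewrite count-false L (P≗false ∘ (u ∷_)) | count-false L (P≗false ∘ (r ∷_)) = refl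

  private
    interchange : ∀ a b c d → a + b + (c + d) ≡ a + c + (b + d)
    interchange = solve-∀

  count-split : ∀ L (P Q : Path → Bool) →
                count L P ≡ count L (λ w → P w ∧ Q w) + count L (λ w → P w ∧ not (Q w))
  count-split zero P Q with P [] | Q []
  ... | true  | true  = refl
  ... | true  | false = refl
  ... | false | _     = refl
  count-split (suc L) P Q
    rewrite count-split L (P ∘ (u ∷_)) (Q ∘ (u ∷_)) | count-split L (P ∘ (r ∷_)) (Q ∘ (r ∷_)) =
    interchange (count L (λ w → P (u ∷ w) ∧ Q (u ∷ w))) (count L (λ w → P (u ∷ w) ∧ not (Q (u ∷ w))))
                (count L (λ w → P (r ∷ w) ∧ Q (r ∷ w))) (count L (λ w → P (r ∷ w) ∧ not (Q (r ∷ w))))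

  startsWith : Path → Path → Bool
  startsWith q w = does (prefix? _≟S_ q w)

  count-startsWith : ∀ q L (P : Path → Bool) →
                     count (length q + L) (λ w → P w ∧ startsWith q w) ≡ count L (λ w → P (q ++ w))
  count-startsWith []      L P = count-cong L (λ w → BP.∧-identityʳ (P w))
  count-startsWith (u ∷ q) L P =
    trans (cong₂ _+_ (count-startsWith q L (P ∘ (u ∷_)))
                     (count-false (length q + L) (λ w → BP.∧-zeroʳ (P (r ∷ w)))))
          (ℕP.+-identityʳ _)
  count-startsWith (r ∷ q) L P =
    cong₂ _+_ (count-false (length q + L) (λ w → BP.∧-zeroʳ (P (u ∷ w))))
              (count-startsWith q L (P ∘ (r ∷_)))

  count-∷ʳ : ∀ L (P : Path → Bool) → count (suc L) P ≡ count L (λ w → P (w ∷ʳ u)) + count L (λ w → P (w ∷ʳ r))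
  count-∷ʳ zero    P = refl
  count-∷ʳ (suc L) P rewrite count-∷ʳ L (P ∘ (u ∷_)) | count-∷ʳ L (P ∘ (r ∷_)) =
    interchange (count L (λ w → P (u ∷ w ∷ʳ u))) (count L (λ w → P (u ∷ w ∷ʳ r)))
                (count L (λ w → P (r ∷ w ∷ʳ u))) (count L (λ w → P (r ∷ w ∷ʳ r)))

  count-reverse : ∀ L (P : Path → Bool) → count L P ≡ count L (P ∘ reverse)
  count-reverse zero    P = refl
  count-reverse (suc L) P =
    trans (count-∷ʳ L P)
          (cong₂ _+_ (trans (count-reverse L (λ w → P (w ∷ʳ u)))
                            (count-cong L (λ w → cong P (sym (LP.unfold-reverse u w)))))
                     (trans (count-reverse L (λ w → P (w ∷ʳ r)))
                            (count-cong L (λ w → cong P (sym (LP.unfold-reverse r w))))))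

  private
    indicator : Bool → ℕ
    indicator true  = 1
    indicator false = 0

    length-filter-∷ : ∀ {Q : Path → Set} (Q? : Decidable Q) w ws →
                      length (filter Q? (w ∷ ws)) ≡ indicator (does (Q? w)) + length (filter Q? ws)
    length-filter-∷ Q? w ws with does (Q? w)
    ... | true  = refl
    ... | false = refl

    length-filter-extensions : ∀ {Q : Path → Set} (Q? : Decidable Q) (ws : List Path) →
      length (filter Q? (concatMap (λ w → (u ∷ w) ∷ (r ∷ w) ∷ []) ws)) ≡
      length (filter (Q? ∘ (u ∷_)) ws) + length (filter (Q? ∘ (r ∷_)) ws)
    length-filter-extensions Q? []       = refl
    length-filter-extensions Q? (w ∷ ws) = begin
      length (filter Q? ((u ∷ w) ∷ (r ∷ w) ∷ _))
        ≡⟨ length-filter-∷ Q? (u ∷ w) _ ⟩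
      a + length (filter Q? ((r ∷ w) ∷ _))
        ≡⟨ cong (a +_) (length-filter-∷ Q? (r ∷ w) _) ⟩
      a + (b + length (filter Q? (concatMap _ ws)))
        ≡⟨ cong (λ t → a + (b + t)) (length-filter-extensions Q? ws) ⟩
      a + (b + (length (filter (Q? ∘ (u ∷_)) ws) + length (filter (Q? ∘ (r ∷_)) ws)))
        ≡⟨ regroup a b _ _ ⟩
      (a + length (filter (Q? ∘ (u ∷_)) ws)) + (b + length (filter (Q? ∘ (r ∷_)) ws))
        ≡⟨ sym (cong₂ _+_ (length-filter-∷ (Q? ∘ (u ∷_)) w ws) (length-filter-∷ (Q? ∘ (r ∷_)) w ws)) ⟩
      length (filter (Q? ∘ (u ∷_)) (w ∷ ws)) + length (filter (Q? ∘ (r ∷_)) (w ∷ ws)) ∎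
      where
      open ≡-Reasoning
      a : ℕ
      a = indicator (does (Q? (u ∷ w)))
      b : ℕ
      b = indicator (does (Q? (r ∷ w)))
      regroup : ∀ a b c d → a + (b + (c + d)) ≡ a + c + (b + d)
      regroup = solve-∀

  length-filter-words : ∀ L {Q : Path → Set} (Q? : Decidable Q) →
                        length (filter Q? (words L)) ≡ count L (does ∘ Q?)
  length-filter-words zero    Q? with does (Q? [])
  ... | true  = refl
  ... | false = refl
  length-filter-words (suc L) Q? =
    trans (length-filter-extensions Q? (words L))
          (cong₂ _+_ (length-filter-words L (Q? ∘ (u ∷_))) (length-filter-words L (Q? ∘ (r ∷_))))

module PathTests where

  open import Data.Nat using (ℕ; zero; suc; _+_; _≤_; _≤ᵇ_; z≤n; s≤s)
  import Data.Nat.Properties as ℕP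
  open import Data.Bool using (Bool; true; false; _∧_; T)
  import Data.Bool.Properties as BP
  open import Data.List using ([]; _∷_; _++_; reverse; _∷ʳ_; [_]; inits)
  import Data.List.Properties as LP
  open import Data.List.Relation.Unary.All as All using (All; []; _∷_)
  import Data.List.Relation.Unary.All.Properties as AllP
  open import Data.List.Relation.Binary.Infix.Heterogeneous as Infix using (Infix; MkView)
  open import Data.List.Relation.Binary.Infix.Heterogeneous.Properties using (infix?)
  open import Data.List.Relation.Binary.Pointwise using (Pointwise-≡⇒≡; ≡⇒Pointwise-≡)
  open import Function.Bundles using (Equivalence)
  open import Relation.Binary.PropositionalEquality hiding ([_])
  open import Relation.Nullary using (does; proof; contradiction)
  open import Relation.Nullary.Decidable using (map′)
  open import Relation.Nullary.Reflects using (fromEquivalence; det)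

  #r-++ : ∀ a b → #r (a ++ b) ≡ #r a + #r b
  #r-++ []      b = refl
  #r-++ (u ∷ a) b = #r-++ a b
  #r-++ (r ∷ a) b = cong suc (#r-++ a b)

  #u-++ : ∀ a b → #u (a ++ b) ≡ #u a + #u b
  #u-++ []      b = refl
  #u-++ (u ∷ a) b = cong suc (#u-++ a b)
  #u-++ (r ∷ a) b = #u-++ a b

  #r-reverse : ∀ v → #r (reverse v) ≡ #r v
  #r-reverse []      = refl
  #r-reverse (x ∷ v) =
    trans (cong #r (LP.unfold-reverse x v))
          (trans (#r-++ (reverse v) [ x ]) (trans (cong (_+ #r [ x ]) (#r-reverse v)) (last x)))
    where
    last : ∀ x → #r v + #r [ x ] ≡ #r (x ∷ v)
    last u = ℕP.+-identityʳ _
    last r = ℕP.+-comm (#r v) 1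

  #u-reverse : ∀ v → #u (reverse v) ≡ #u v
  #u-reverse []      = refl
  #u-reverse (x ∷ v) =
    trans (cong #u (LP.unfold-reverse x v))
          (trans (#u-++ (reverse v) [ x ]) (trans (cong (_+ #u [ x ]) (#u-reverse v)) (last x)))
    where
    last : ∀ x → #u v + #u [ x ] ≡ #u (x ∷ v)
    last r = ℕP.+-identityʳ _
    last u = ℕP.+-comm (#u v) 1

  BallotFrom : ℕ → Path → Set
  BallotFrom h w = All (λ p → #r p ≤ h + #u p) (inits w)

  ballotFrom : ℕ → Path → Bool
  ballotFrom h       []      = true
  ballotFrom h       (u ∷ w) = ballotFrom (suc h) w
  ballotFrom zero    (r ∷ w) = false
  ballotFrom (suc h) (r ∷ w) = ballotFrom h w

  ballotFrom-complete : ∀ h w → BallotFrom h w → T (ballotFrom h w)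
  ballotFrom-complete h       []      _        = _
  ballotFrom-complete h       (u ∷ w) (_ ∷ ps) =
    ballotFrom-complete (suc h) w (All.map (λ {p} → subst (#r p ≤_) (ℕP.+-suc h (#u p))) (AllP.map⁻ ps))
  ballotFrom-complete zero    (r ∷ w) (_ ∷ (() ∷ _))
  ballotFrom-complete (suc h) (r ∷ w) (_ ∷ ps) =
    ballotFrom-complete h w (All.map (λ { (s≤s le) → le }) (AllP.map⁻ ps))

  ballotFrom-sound : ∀ h w → T (ballotFrom h w) → BallotFrom h w
  ballotFrom-sound h       []      _ = z≤n ∷ []
  ballotFrom-sound h       (u ∷ w) t =
    z≤n ∷ AllP.map⁺ (All.map (λ {p} → subst (#r p ≤_) (sym (ℕP.+-suc h (#u p)))) (ballotFrom-sound (suc h) w t))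
  ballotFrom-sound (suc h) (r ∷ w) t = z≤n ∷ AllP.map⁺ (All.map s≤s (ballotFrom-sound h w t))

  does-ballot? : ∀ w → does (ballot? w) ≡ ballotFrom 0 w
  does-ballot? w = det (proof (ballot? w)) (fromEquivalence (ballotFrom-sound 0 w) (ballotFrom-complete 0 w))

  ballotFrom-∷ʳ-u : ∀ h w → ballotFrom h (w ∷ʳ u) ≡ ballotFrom h w
  ballotFrom-∷ʳ-u h       []      = refl
  ballotFrom-∷ʳ-u h       (u ∷ w) = ballotFrom-∷ʳ-u (suc h) w
  ballotFrom-∷ʳ-u zero    (r ∷ w) = refl
  ballotFrom-∷ʳ-u (suc h) (r ∷ w) = ballotFrom-∷ʳ-u h w

  ballotFrom-∷ʳ-r : ∀ h w → ballotFrom h (w ∷ʳ r) ≡ ballotFrom h w ∧ (suc (#r w) ≤ᵇ h + #u w)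
  ballotFrom-∷ʳ-r zero    []      = refl
  ballotFrom-∷ʳ-r (suc h) []      = refl
  ballotFrom-∷ʳ-r h       (u ∷ w) =
    trans (ballotFrom-∷ʳ-r (suc h) w)
          (cong (λ t → ballotFrom (suc h) w ∧ (suc (#r w) ≤ᵇ t)) (sym (ℕP.+-suc h (#u w))))
  ballotFrom-∷ʳ-r zero    (r ∷ w) = refl
  ballotFrom-∷ʳ-r (suc h) (r ∷ w) = ballotFrom-∷ʳ-r h w

  ballotFrom-endpoint : ∀ h w → T (ballotFrom h w) → #r w ≤ h + #u w
  ballotFrom-endpoint h       []      _ = z≤n
  ballotFrom-endpoint h       (u ∷ w) t = subst (#r w ≤_) (sym (ℕP.+-suc h (#u w))) (ballotFrom-endpoint (suc h) w t)
  ballotFrom-endpoint (suc h) (r ∷ w) t = s≤s (ballotFrom-endpoint h w t)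

  -- The ballot condition read backwards from an endpoint c units above the diagonal.
  reverseBallot : ℕ → Path → Bool
  reverseBallot c       []      = true
  reverseBallot c       (r ∷ v) = reverseBallot (suc c) v
  reverseBallot zero    (u ∷ v) = false
  reverseBallot (suc c) (u ∷ v) = reverseBallot c v

  ballotFrom-reverse : ∀ v h c → h + #u v ≡ c + #r v → ballotFrom h (reverse v) ≡ reverseBallot c v
  ballotFrom-reverse []      h c       _ = refl
  ballotFrom-reverse (u ∷ v) h c e rewrite LP.unfold-reverse u v | ballotFrom-∷ʳ-u h (reverse v) with c
  ... | suc c′ = ballotFrom-reverse v h c′ (ℕP.suc-injective (trans (sym (ℕP.+-suc h (#u v))) e))
  ... | zero with ballotFrom h (reverse v) in eq
  ...   | false = refl
  ...   | true  = contradiction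
          (ℕP.≤-trans (s≤s (subst₂ (λ a b → a ≤ h + b) (#r-reverse v) (#u-reverse v)
                                   (ballotFrom-endpoint h (reverse v) (subst T (sym eq) _))))
                      (ℕP.≤-reflexive (trans (sym (ℕP.+-suc h (#u v))) e)))
          (ℕP.<-irrefl refl)
  ballotFrom-reverse (r ∷ v) h c e = via-last-step (trans e (ℕP.+-suc c (#r v)))
    where
    via-last-step : h + #u v ≡ suc c + #r v → ballotFrom h (reverse (r ∷ v)) ≡ reverseBallot c (r ∷ v)
    via-last-step e′
      rewrite LP.unfold-reverse r v | ballotFrom-∷ʳ-r h (reverse v) | #r-reverse v | #u-reverse v
            | Equivalence.to BP.T-≡ (ℕP.≤⇒≤ᵇ (subst (suc (#r v) ≤_) (sym e′) (s≤s (ℕP.m≤n+m (#r v) c)))) =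
      trans (BP.∧-identityʳ _) (ballotFrom-reverse v h (suc c) e′)

  occurs : Path → Path → Bool
  occurs p w = does (infix? _≟S_ p w)

  Infix-reverse : ∀ {p w : Path} → Infix _≡_ p w → Infix _≡_ (reverse p) (reverse w)
  Infix-reverse i with Infix.toView i
  ... | MkView pre {inf} p≋inf suf =
    subst (Infix _≡_ _) (sym reverse-split)
          (Infix.fromView (MkView (reverse suf) (≡⇒Pointwise-≡ (cong reverse (Pointwise-≡⇒≡ p≋inf))) (reverse pre)))
    where
    reverse-split : reverse (pre ++ inf ++ suf) ≡ reverse suf ++ reverse inf ++ reverse pre
    reverse-split = trans (LP.reverse-++ pre (inf ++ suf))
                          (trans (cong (_++ reverse pre) (LP.reverse-++ inf suf))
                                 (LP.++-assoc (reverse suf) (reverse inf) (reverse pre)))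

  occurs-reverse : ∀ p v → reverse p ≡ p → occurs p (reverse v) ≡ occurs p v
  occurs-reverse p v palindrome =
    det (proof (map′ from-reversed to-reversed (infix? _≟S_ p (reverse v)))) (proof (infix? _≟S_ p v))
    where
    from-reversed : Infix _≡_ p (reverse v) → Infix _≡_ p v
    from-reversed i = subst₂ (Infix _≡_) palindrome (LP.reverse-involutive v) (Infix-reverse i)
    to-reversed : Infix _≡_ p v → Infix _≡_ p (reverse v)
    to-reversed i = subst (λ q → Infix _≡_ q (reverse v)) palindrome (Infix-reverse i)

  pat-suc : ∀ k → pat (suc k) ≡ pat k ++ u ∷ r ∷ []
  pat-suc zero    = refl
  pat-suc (suc k) = cong (λ t → r ∷ u ∷ t) (pat-suc k)

  pat-palindrome : ∀ k → reverse (pat k) ≡ pat k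
  pat-palindrome zero    = refl
  pat-palindrome (suc k) =
    trans (cong reverse (pat-suc k))
          (trans (LP.reverse-++ (pat k) (u ∷ r ∷ [])) (cong (λ t → r ∷ u ∷ t) (pat-palindrome k)))

module PathRecurrence (k′ : ℕ) where

  open Recurrence
  open Counting
  open PathTests
  open import Data.Nat as ℕ using (ℕ; zero; suc; _+_; _≤_; _<_; _≡ᵇ_; s≤s)
  import Data.Nat.Properties as ℕP
  open import Data.Nat.Tactic.RingSolver using (solve-∀)
  open import Data.Integer as ℤ using (ℤ; +_; _-_)
  import Data.Integer.Properties as ℤP
  import Data.Integer.Tactic.RingSolver as ℤ-Solver
  open import Data.Bool using (Bool; true; false; _∧_; _∨_; not; T)
  import Data.Bool.Properties as BP
  open import Data.List using ([]; _∷_; _++_; length; reverse)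
  open import Relation.Binary.PropositionalEquality
  open import Relation.Nullary using (does; contradiction; _×-dec_)

  k : ℕ
  k = suc k′

  p : Path
  p = pat k

  -- A path to (n, n + d), read backwards from its endpoint.
  admissible : ℕ → ℕ → Path → Bool
  admissible n d v = ((#r v ≡ᵇ n) ∧ (#u v ≡ᵇ n + d)) ∧ (reverseBallot d v ∧ not (occurs p v))

  len : ℕ → ℕ → ℕ
  len n d = n + (n + d)

  paths : ℕ → ℕ → ℕ
  paths n d = count (len n d) (admissible n d)

  ballotAvoid≡paths : ∀ n d → ballotAvoid p n (n + d) ≡ paths n d
  ballotAvoid≡paths n d =
    trans (length-filter-words (len n d) _)
          (trans (count-reverse (len n d) _) (count-cong (len n d) reversed))
    where
    reversed : ∀ v → does (endsAt? n (n + d) (reverse v) ×-dec (ballot? (reverse v) ×-dec avoids? p (reverse v)))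
                   ≡ admissible n d v
    reversed v
      rewrite does-ballot? (reverse v) | occurs-reverse p v (pat-palindrome k) | #r-reverse v | #u-reverse v
      with #r v ≡ᵇ n in r≡n | #u v ≡ᵇ n + d in u≡n+d
    ... | false | _     = refl
    ... | true  | false = refl
    ... | true  | true  = cong (_∧ not (occurs p v)) (ballotFrom-reverse v 0 d
      (trans (≡ᵇ⇒≡ u≡n+d) (trans (ℕP.+-comm n d) (cong (_+_ d) (sym (≡ᵇ⇒≡ r≡n))))))
      where
      ≡ᵇ⇒≡ : ∀ {a b} → (a ≡ᵇ b) ≡ true → a ≡ b
      ≡ᵇ⇒≡ {a} {b} eq = ℕP.≡ᵇ⇒≡ a b (subst T (sym eq) _)

  private
    ∧-not-∨ : ∀ a g x o → a ∧ (g ∧ not (x ∨ o)) ≡ (a ∧ (g ∧ not o)) ∧ not x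
    ∧-not-∨ true  true  true  o = sym (BP.∧-zeroʳ _)
    ∧-not-∨ true  true  false o = sym (BP.∧-identityʳ _)
    ∧-not-∨ true  false x     o = refl
    ∧-not-∨ false g     x     o = refl

    ∨-absorb : ∀ x y z → (T y → T x) → x ∨ (y ∨ z) ≡ x ∨ z
    ∨-absorb true  y     z _   = refl
    ∨-absorb false true  z y⇒x = contradiction (y⇒x _) (λ ())
    ∨-absorb false false z _   = refl

    ≡ᵇ-cancelˡ : ∀ k x j → (k + x ≡ᵇ k + j) ≡ (x ≡ᵇ j)
    ≡ᵇ-cancelˡ zero    x j = refl
    ≡ᵇ-cancelˡ (suc k) x j = ≡ᵇ-cancelˡ k x j

  #r-urPow : ∀ j → #r (urPow j) ≡ j
  #r-urPow zero    = refl
  #r-urPow (suc j) = cong suc (#r-urPow j)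

  #u-urPow : ∀ j → #u (urPow j) ≡ j
  #u-urPow zero    = refl
  #u-urPow (suc j) = cong suc (#u-urPow j)

  length-urPow : ∀ j → length (urPow j) ≡ j + j
  length-urPow zero    = refl
  length-urPow (suc j) = cong suc (trans (cong suc (length-urPow j)) (sym (ℕP.+-suc j j)))

  urPow-+ : ∀ a b → urPow (a + b) ≡ urPow a ++ urPow b
  urPow-+ zero    b = refl
  urPow-+ (suc a) b = cong (λ t → u ∷ r ∷ t) (urPow-+ a b)

  startsWith-#r : ∀ q v → T (startsWith q v) → #r q ≤ #r v
  startsWith-#r []      v       _ = ℕ.z≤n
  startsWith-#r (u ∷ q) (u ∷ v) t = startsWith-#r q v t
  startsWith-#r (r ∷ q) (r ∷ v) t = s≤s (startsWith-#r q v t)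

  startsWith-++ : ∀ q q′ v → startsWith (q ++ q′) (q ++ v) ≡ startsWith q′ v
  startsWith-++ []      q′ v = refl
  startsWith-++ (u ∷ q) q′ v = startsWith-++ q q′ v
  startsWith-++ (r ∷ q) q′ v = startsWith-++ q q′ v

  startsWith-urPow-suc : ∀ a v → T (startsWith (urPow (suc a)) v) → T (startsWith (urPow a) v)
  startsWith-urPow-suc zero    v           _ = _
  startsWith-urPow-suc (suc a) (u ∷ r ∷ v) t = startsWith-urPow-suc a v t

  reverseBallot-urPow : ∀ j d v → reverseBallot (suc d) (urPow j ++ v) ≡ reverseBallot (suc d) v
  reverseBallot-urPow zero    d v = refl
  reverseBallot-urPow (suc j) d v = reverseBallot-urPow j d v

  -- An occurrence of r(ur)ᵏ meeting the prefix (ur)^{j+1} with k = m + j + 1 forces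
  -- (ur)^{m+1} to start the rest; the shortest such condition, (ur)¹, absorbs the others.
  occurs-urPow-++ : ∀ j m v → k ≡ m + suc j →
                    occurs p (urPow (suc j) ++ v) ≡ startsWith (urPow (suc m)) v ∨ occurs p v
  occurs-urPow-++ zero    m v k≡ = cong (λ t → startsWith (urPow t) v ∨ occurs p v) (trans k≡ (ℕP.+-comm m 1))
  occurs-urPow-++ (suc j) m v k≡ =
    trans (cong (_∨ occurs p (urPow (suc j) ++ v))
                (trans (cong (λ t → startsWith (urPow t) (urPow (suc j) ++ v))
                             (trans k≡ (trans (ℕP.+-comm m (suc (suc j))) (sym (ℕP.+-suc (suc j) m)))))
                       (trans (cong (λ t → startsWith t (urPow (suc j) ++ v)) (urPow-+ (suc j) (suc m)))
                              (startsWith-++ (urPow (suc j)) (urPow (suc m)) v))))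
          (trans (cong (startsWith (urPow (suc m)) v ∨_) (occurs-urPow-++ j (suc m) v (trans k≡ (ℕP.+-suc m (suc j)))))
                 (∨-absorb _ _ _ (startsWith-urPow-suc (suc m) v)))

  admissible-u : ∀ n d v → admissible n (suc d) (u ∷ v) ≡ admissible n d v
  admissible-u n d v rewrite ℕP.+-suc n d = refl

  admissible-u-0 : ∀ n v → admissible n 0 (u ∷ v) ≡ false
  admissible-u-0 n v = BP.∧-zeroʳ _

  admissible-r : ∀ n d v → admissible (suc n) d (r ∷ v) ≡ admissible n (suc d) v ∧ not (startsWith (urPow k) v)
  admissible-r n d v rewrite ℕP.+-suc n d =
    ∧-not-∨ ((#r v ≡ᵇ n) ∧ (#u v ≡ᵇ suc (n + d))) (reverseBallot (suc d) v) (startsWith (urPow k) v) (occurs p v)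

  admissible-urPow : ∀ j d v → admissible (k + j) (suc d) (urPow k ++ v) ≡
                               admissible j (suc d) v ∧ not (startsWith (u ∷ r ∷ []) v)
  admissible-urPow j d v = strip k (occurs-urPow-++ k′ 0 v refl)
    where
    -- stated for a variable K, so that urPow K does not unfold before the rewrites below
    strip : ∀ K → occurs p (urPow K ++ v) ≡ startsWith (u ∷ r ∷ []) v ∨ occurs p v →
            admissible (K + j) (suc d) (urPow K ++ v) ≡ admissible j (suc d) v ∧ not (startsWith (u ∷ r ∷ []) v)
    strip K occ
      rewrite #r-++ (urPow K) v | #u-++ (urPow K) v | #r-urPow K | #u-urPow K
            | ≡ᵇ-cancelˡ K (#r v) j | ℕP.+-assoc K j (suc d) | ≡ᵇ-cancelˡ K (#u v) (j + suc d)
            | reverseBallot-urPow K d v | occ =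
      ∧-not-∨ ((#r v ≡ᵇ j) ∧ (#u v ≡ᵇ j + suc d)) (reverseBallot (suc d) v) (startsWith (u ∷ r ∷ []) v) (occurs p v)

  admissible-urPow-below : ∀ m c v → m < k → admissible m c v ∧ startsWith (urPow k) v ≡ false
  admissible-urPow-below m c v m<k with #r v ≡ᵇ m in r≡m
  ... | false = refl
  ... | true with startsWith (urPow k) v in starts
  ...   | false = BP.∧-zeroʳ _
  ...   | true  = contradiction
          (subst₂ _≤_ (#r-urPow k) (ℕP.≡ᵇ⇒≡ _ m (subst T (sym r≡m) _)) (startsWith-#r (urPow k) v (subst T (sym starts) _)))
          (ℕP.<⇒≱ m<k)

  A : ℕ → ℕ → ℤ
  A n d = + paths n d

  withPrefix withoutPrefix : Path → ℕ → ℕ → ℕ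
  withPrefix    q n d = count (len n d) (λ v → admissible n d v ∧ startsWith q v)
  withoutPrefix q n d = count (len n d) (λ v → admissible n d v ∧ not (startsWith q v))

  withoutPrefix≡A-withPrefix : ∀ q n d → + withoutPrefix q n d ≡ A n d - + withPrefix q n d
  withoutPrefix≡A-withPrefix q n d = begin
    + withoutPrefix q n d                                       ≡⟨ cancel (+ withPrefix q n d) _ ⟩
    + withPrefix q n d ℤ.+ + withoutPrefix q n d - + withPrefix q n d
      ≡⟨ cong (_- + withPrefix q n d) (sym (ℤP.pos-+ (withPrefix q n d) _)) ⟩
    + (withPrefix q n d + withoutPrefix q n d) - + withPrefix q n d
      ≡⟨ cong (λ t → + t - + withPrefix q n d) (sym (count-split (len n d) (admissible n d) (startsWith q))) ⟩
    A n d - + withPrefix q n d ∎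
    where
    open ≡-Reasoning
    cancel : ∀ a b → b ≡ a ℤ.+ b - a
    cancel = ℤ-Solver.solve-∀

  private
    length-shuffle : ∀ n d → n + suc (n + suc d) ≡ suc n + (suc n + d)
    length-shuffle = solve-∀

  paths-0 : ∀ d → paths 0 d ≡ 1
  paths-0 zero    = refl
  paths-0 (suc d) =
    trans (cong₂ _+_ (count-cong d (admissible-u 0 d)) (count-false d (λ _ → refl)))
          (trans (ℕP.+-identityʳ _) (paths-0 d))

  lastStep-u : ∀ n d → + count (n + suc (n + d)) (λ v → admissible (suc n) d (u ∷ v)) ≡ shiftDown A (suc n) d
  lastStep-u n zero    = cong +_ (count-false (n + suc (n + 0)) (admissible-u-0 (suc n)))
  lastStep-u n (suc d) = cong +_ (trans (count-cong (n + suc (n + suc d)) (admissible-u (suc n) d))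
                                        (cong (λ L → count L (admissible (suc n) d)) (length-shuffle n d)))

  lastStep-r : ∀ n d → count (n + suc (n + d)) (λ v → admissible (suc n) d (r ∷ v)) ≡ withoutPrefix (urPow k) n (suc d)
  lastStep-r n d =
    trans (count-cong (n + suc (n + d)) (admissible-r n d))
          (cong (λ L → count L (λ v → admissible n (suc d) v ∧ not (startsWith (urPow k) v)))
                (cong (_+_ n) (sym (ℕP.+-suc n d))))

  Δ-paths : ∀ n d → Δ A (suc n) d ≡ + withoutPrefix (urPow k) n (suc d)
  Δ-paths n d = begin
    + (byU + byR) - shiftDown A (suc n) d   ≡⟨ cong₂ _-_ (ℤP.pos-+ byU byR) (sym (lastStep-u n d)) ⟩
    + byU ℤ.+ + byR - + byU                  ≡⟨ cancel (+ byU) (+ byR) ⟩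
    + byR                                    ≡⟨ cong +_ (lastStep-r n d) ⟩
    + withoutPrefix (urPow k) n (suc d)      ∎
    where
    open ≡-Reasoning
    byU : ℕ
    byU = count (n + suc (n + d)) (λ v → admissible (suc n) d (u ∷ v))
    byR : ℕ
    byR = count (n + suc (n + d)) (λ v → admissible (suc n) d (r ∷ v))
    cancel : ∀ a b → a ℤ.+ b - a ≡ b
    cancel = ℤ-Solver.solve-∀

  withPrefix-urPow-below : ∀ m c → m < k → withPrefix (urPow k) m c ≡ 0
  withPrefix-urPow-below m c m<k = count-false (len m c) (λ v → admissible-urPow-below m c v m<k)

  withPrefix-urPow-above : ∀ j d → withPrefix (urPow k) (k + j) (suc d) ≡ withoutPrefix (u ∷ r ∷ []) j (suc d)
  withPrefix-urPow-above j d =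
    trans (cong (λ L → count L (λ v → admissible (k + j) (suc d) v ∧ startsWith (urPow k) v))
                (trans (regroup k j (suc d)) (cong (_+ len j (suc d)) (sym (length-urPow k)))))
          (trans (count-startsWith (urPow k) (len j (suc d)) (admissible (k + j) (suc d)))
                 (count-cong (len j (suc d)) (admissible-urPow j d)))
    where
    regroup : ∀ k j c → (k + j) + ((k + j) + c) ≡ (k + k) + (j + (j + c))
    regroup = solve-∀

  private
    len-suc : ∀ j d → j + (j + suc d) ≡ suc (j + (j + d))
    len-suc = solve-∀

  withPrefix-ur : ∀ j d → withPrefix (u ∷ r ∷ []) j (suc d) ≡ withPrefix (r ∷ []) j d
  withPrefix-ur j d =
    trans (cong (λ L → count L (λ v → admissible j (suc d) v ∧ startsWith (u ∷ r ∷ []) v)) (len-suc j d))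
          (trans (cong₂ _+_ (count-cong (len j d) (λ v → cong (_∧ startsWith (r ∷ []) v) (admissible-u j d v)))
                            (count-false (len j d) (λ v → BP.∧-zeroʳ (admissible j (suc d) (r ∷ v)))))
                 (ℕP.+-identityʳ _))

  withoutPrefix-r : ∀ j d → + withoutPrefix (r ∷ []) j d ≡ shiftDown A j d
  withoutPrefix-r zero    zero    = refl
  withoutPrefix-r (suc j) zero    = cong +_ (cong₂ _+_
    (count-false (j + suc (j + 0)) (λ v → trans (BP.∧-identityʳ _) (admissible-u-0 (suc j) v)))
    (count-false (j + suc (j + 0)) (λ v → BP.∧-zeroʳ (admissible (suc j) 0 (r ∷ v)))))
  withoutPrefix-r j       (suc d) = cong +_ (trans
    (cong (λ L → count L (λ v → admissible j (suc d) v ∧ not (startsWith (r ∷ []) v))) (len-suc j d))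
    (trans (cong₂ _+_ (count-cong (len j d) (λ v → trans (BP.∧-identityʳ _) (admissible-u j d v)))
                      (count-false (len j d) (λ v → BP.∧-zeroʳ (admissible j (suc d) (r ∷ v)))))
           (ℕP.+-identityʳ _)))

  Δ≡withPrefix-r : ∀ j d → Δ A j d ≡ + withPrefix (r ∷ []) j d
  Δ≡withPrefix-r j d = begin
    A j d - shiftDown A j d                              ≡⟨ cong (_-_ (A j d)) (sym (withoutPrefix-r j d)) ⟩
    A j d - + withoutPrefix (r ∷ []) j d                 ≡⟨ cong (_-_ (A j d)) (withoutPrefix≡A-withPrefix (r ∷ []) j d) ⟩
    A j d - (A j d - + withPrefix (r ∷ []) j d)          ≡⟨ cancel (A j d) _ ⟩
    + withPrefix (r ∷ []) j d                            ∎
    where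
    open ≡-Reasoning
    cancel : ∀ a b → a - (a - b) ≡ b
    cancel = ℤ-Solver.solve-∀

  withPrefix-urPow-above-ℤ : ∀ j d → + withPrefix (urPow k) (k + j) (suc d) ≡ A j (suc d) - Δ A j d
  withPrefix-urPow-above-ℤ j d = begin
    + withPrefix (urPow k) (k + j) (suc d)        ≡⟨ cong +_ (withPrefix-urPow-above j d) ⟩
    + withoutPrefix (u ∷ r ∷ []) j (suc d)         ≡⟨ withoutPrefix≡A-withPrefix (u ∷ r ∷ []) j (suc d) ⟩
    A j (suc d) - + withPrefix (u ∷ r ∷ []) j (suc d) ≡⟨ cong (λ t → A j (suc d) - + t) (withPrefix-ur j d) ⟩
    A j (suc d) - + withPrefix (r ∷ []) j d        ≡⟨ cong (_-_ (A j (suc d))) (sym (Δ≡withPrefix-r j d)) ⟩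
    A j (suc d) - Δ A j d                          ∎
    where open ≡-Reasoning

  paths-satisfiesRecurrence : SatisfiesRecurrence k A
  paths-satisfiesRecurrence = record
    { base    = λ d → cong +_ (paths-0 d)
    ; Δ-below = Δ-below
    ; Δ-above = Δ-above
    }
    where
    Δ-below : ∀ n d → n < k → Δ A (suc n) d ≡ A n (suc d)
    Δ-below n d n<k =
      trans (Δ-paths n d)
            (trans (withoutPrefix≡A-withPrefix (urPow k) n (suc d))
                   (trans (cong (λ t → A n (suc d) - + t) (withPrefix-urPow-below n (suc d) n<k))
                          (ℤP.+-identityʳ _)))

    Δ-above : ∀ n d → Δ A (suc (k + n)) d - Δ A n d ≡ A (k + n) (suc d) - A n (suc d)
    Δ-above n d = begin
      Δ A (suc x) d - Δ A n d
        ≡⟨ cong (_- Δ A n d) (trans (Δ-paths x d) (withoutPrefix≡A-withPrefix (urPow k) x (suc d))) ⟩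
      A x (suc d) - + withPrefix (urPow k) x (suc d) - Δ A n d
        ≡⟨ cong (λ t → A x (suc d) - t - Δ A n d) (withPrefix-urPow-above-ℤ n d) ⟩
      A x (suc d) - (A n (suc d) - Δ A n d) - Δ A n d
        ≡⟨ cancel (A x (suc d)) (A n (suc d)) (Δ A n d) ⟩
      A x (suc d) - A n (suc d) ∎
      where
      open ≡-Reasoning
      x : ℕ
      x = k + n
      cancel : ∀ a b c → a - (b - c) - c ≡ a - b
      cancel = ℤ-Solver.solve-∀

module RationalSums where

  open import Data.Nat as ℕ using (ℕ; zero; suc)
  import Data.Nat.Properties as ℕP
  open import Data.Integer as ℤ using (ℤ; +_; 1ℤ)
  import Data.Integer.Properties as ℤP
  open import Data.Integer.Tactic.RingSolver using (solve-∀)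
  open import Data.Rational as ℚ using (ℚ; _/_; toℚᵘ)
  import Data.Rational.Properties as ℚP
  open import Data.Rational.Unnormalised as ℚᵘ using (mkℚᵘ; *≡*) renaming (_≃_ to _≃ᵘ_)
  import Data.Rational.Unnormalised.Properties as ℚᵘP
  open import Relation.Binary.PropositionalEquality

  toℚᵘ-/ : ∀ a n → toℚᵘ (a / suc n) ≃ᵘ mkℚᵘ a n
  toℚᵘ-/ a n = ℚP.toℚᵘ-fromℚᵘ (mkℚᵘ a n)

  ℤtoℚ-+ : ∀ a b → ℤtoℚ (a ℤ.+ b) ≡ ℤtoℚ a ℚ.+ ℤtoℚ b
  ℤtoℚ-+ a b = ℚP.toℚᵘ-injective (begin
    toℚᵘ (ℤtoℚ (a ℤ.+ b))               ≈⟨ toℚᵘ-/ (a ℤ.+ b) 0 ⟩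
    mkℚᵘ (a ℤ.+ b) 0                    ≈⟨ *≡* (tidy a b) ⟩
    mkℚᵘ a 0 ℚᵘ.+ mkℚᵘ b 0              ≈⟨ ℚᵘP.+-cong (toℚᵘ-/ a 0) (toℚᵘ-/ b 0) ⟨
    toℚᵘ (ℤtoℚ a) ℚᵘ.+ toℚᵘ (ℤtoℚ b)    ≈⟨ ℚP.toℚᵘ-homo-+ (ℤtoℚ a) (ℤtoℚ b) ⟨
    toℚᵘ (ℤtoℚ a ℚ.+ ℤtoℚ b)            ∎)
    where
    open ℚᵘP.≃-Reasoning
    tidy : ∀ a b → (a ℤ.+ b) ℤ.* 1ℤ ≡ (a ℤ.* 1ℤ ℤ.+ b ℤ.* 1ℤ) ℤ.* 1ℤ
    tidy = solve-∀

  sumℚ-ℤtoℚ : ∀ n (f : ℕ → ℤ) → sumℚ n (λ i → ℤtoℚ (f i)) ≡ ℤtoℚ (sumℤ n f)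
  sumℚ-ℤtoℚ zero    f = refl
  sumℚ-ℤtoℚ (suc n) f =
    trans (cong (ℚ._+ ℤtoℚ (f (suc n))) (sumℚ-ℤtoℚ n f)) (sym (ℤtoℚ-+ (sumℤ n f) (f (suc n))))

  sumℚ-cong : ∀ n {f g : ℕ → ℚ} → (∀ i → f i ≡ g i) → sumℚ n f ≡ sumℚ n g
  sumℚ-cong zero    f≗g = f≗g 0
  sumℚ-cong (suc n) f≗g = cong₂ ℚ._+_ (sumℚ-cong n f≗g) (f≗g (suc n))

  *-distribˡ-sumℚ : ∀ n (q : ℚ) (f : ℕ → ℚ) → q ℚ.* sumℚ n f ≡ sumℚ n (λ i → q ℚ.* f i)
  *-distribˡ-sumℚ zero    q f = refl
  *-distribˡ-sumℚ (suc n) q f =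
    trans (ℚP.*-distribˡ-+ q (sumℚ n f) (f (suc n))) (cong (ℚ._+ (q ℚ.* f (suc n))) (*-distribˡ-sumℚ n q f))

  ballotTerm≡ : ∀ (c : ℤ) (s t C B : ℕ) → suc s ℕ.* C ≡ suc t ℕ.* B →
                ℕtoℚ (suc s) ℚ.* (ℤtoℚ c ℚ.* ((1ℤ / suc t) ℚ.* ℕtoℚ C)) ≡ ℤtoℚ (c ℤ.* + B)
  ballotTerm≡ c s t C B sC≡tB = ℚP.toℚᵘ-injective (begin
    toℚᵘ (ℕtoℚ (suc s) ℚ.* (ℤtoℚ c ℚ.* ((1ℤ / suc t) ℚ.* ℕtoℚ C)))
      ≈⟨ ℚP.toℚᵘ-homo-* (ℕtoℚ (suc s)) _ ⟩
    toℚᵘ (ℕtoℚ (suc s)) ℚᵘ.* toℚᵘ (ℤtoℚ c ℚ.* ((1ℤ / suc t) ℚ.* ℕtoℚ C))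
      ≈⟨ ℚᵘP.*-congˡ {toℚᵘ (ℕtoℚ (suc s))}
           (ℚᵘP.≃-trans (ℚP.toℚᵘ-homo-* (ℤtoℚ c) _) (ℚᵘP.*-congˡ {toℚᵘ (ℤtoℚ c)} (ℚP.toℚᵘ-homo-* (1ℤ / suc t) _))) ⟩
    toℚᵘ (ℕtoℚ (suc s)) ℚᵘ.* (toℚᵘ (ℤtoℚ c) ℚᵘ.* (toℚᵘ (1ℤ / suc t) ℚᵘ.* toℚᵘ (ℕtoℚ C)))
      ≈⟨ ℚᵘP.*-cong (toℚᵘ-/ (+ suc s) 0) (ℚᵘP.*-cong (toℚᵘ-/ c 0) (ℚᵘP.*-cong (toℚᵘ-/ 1ℤ t) (toℚᵘ-/ (+ C) 0))) ⟩
    mkℚᵘ (+ suc s) 0 ℚᵘ.* (mkℚᵘ c 0 ℚᵘ.* (mkℚᵘ 1ℤ t ℚᵘ.* mkℚᵘ (+ C) 0))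
      ≈⟨ *≡* cross-multiplied ⟩
    mkℚᵘ (c ℤ.* + B) 0
      ≈⟨ toℚᵘ-/ (c ℤ.* + B) 0 ⟨
    toℚᵘ (ℤtoℚ (c ℤ.* + B)) ∎)
    where
    open ℚᵘP.≃-Reasoning
    cross-multiplied : (+ suc s ℤ.* (c ℤ.* (1ℤ ℤ.* + C))) ℤ.* 1ℤ ≡ (c ℤ.* + B) ℤ.* + (1 ℕ.* (1 ℕ.* (suc t ℕ.* 1)))
    cross-multiplied =
      trans (reassoc (+ suc s) c (+ C))
            (trans (cong (c ℤ.*_) (trans (sym (ℤP.pos-* (suc s) C)) (trans (cong +_ sC≡tB) (ℤP.pos-* (suc t) B))))
                   (trans (swap c (+ suc t) (+ B))
                          (cong (λ x → (c ℤ.* + B) ℤ.* + x)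
                                (sym (trans (ℕP.*-identityˡ _) (trans (ℕP.*-identityˡ _) (ℕP.*-identityʳ _)))))))
      where
      reassoc : ∀ s c x → (s ℤ.* (c ℤ.* (1ℤ ℤ.* x))) ℤ.* 1ℤ ≡ c ℤ.* (s ℤ.* x)
      reassoc = solve-∀
      swap : ∀ c t b → c ℤ.* (t ℤ.* b) ≡ (c ℤ.* b) ℤ.* t
      swap = solve-∀

  catalanTerm≡ : ∀ (c : ℤ) (i C B : ℕ) → C ≡ suc i ℕ.* B → ((+ C) / suc i) ℚ.* ℤtoℚ c ≡ ℤtoℚ (c ℤ.* + B)
  catalanTerm≡ c i C B C≡iB = ℚP.toℚᵘ-injective (begin
    toℚᵘ ((+ C / suc i) ℚ.* ℤtoℚ c)             ≈⟨ ℚP.toℚᵘ-homo-* (+ C / suc i) (ℤtoℚ c) ⟩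
    toℚᵘ (+ C / suc i) ℚᵘ.* toℚᵘ (ℤtoℚ c)       ≈⟨ ℚᵘP.*-cong (toℚᵘ-/ (+ C) i) (toℚᵘ-/ c 0) ⟩
    mkℚᵘ (+ C) i ℚᵘ.* mkℚᵘ c 0                   ≈⟨ *≡* cross-multiplied ⟩
    mkℚᵘ (c ℤ.* + B) 0                           ≈⟨ toℚᵘ-/ (c ℤ.* + B) 0 ⟨
    toℚᵘ (ℤtoℚ (c ℤ.* + B))                      ∎)
    where
    open ℚᵘP.≃-Reasoning
    cross-multiplied : (+ C ℤ.* c) ℤ.* 1ℤ ≡ (c ℤ.* + B) ℤ.* + (suc i ℕ.* 1)
    cross-multiplied =
      trans (cong (λ x → (+ x ℤ.* c) ℤ.* 1ℤ) C≡iB)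
            (trans (cong (λ x → (x ℤ.* c) ℤ.* 1ℤ) (ℤP.pos-* (suc i) B))
                   (trans (swap (+ suc i) (+ B) c) (cong (λ x → (c ℤ.* + B) ℤ.* + x) (sym (ℕP.*-identityʳ (suc i))))))
      where
      swap : ∀ s b c → (s ℤ.* b ℤ.* c) ℤ.* 1ℤ ≡ (c ℤ.* b) ℤ.* s
      swap = solve-∀

open Recurrence using (recurrence-unique)
open BallotNumbers using (ballotNumber; ballotNumber-closedForm)
open RationalSums
open import Data.Nat using (suc; _+_; _*_; _∸_; z≤n; s≤s)
import Data.Nat.Properties as ℕP
open import Data.Nat.Combinatorics using (_C_)
open import Data.Integer as ℤ using (+_)
open import Data.Product using (_,_)
open import Relation.Binary.PropositionalEquality using (sym; trans; cong)

mainTheorem7 : (k : ℕ) → 1 ≤ k →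
    ((n m : ℕ) → n ≤ m → ℕtoℚ (ballotAvoid (pat k) n m) ≡ ballotFormula k n m)
    × ((n : ℕ) → ℕtoℚ (dyckAvoid (pat k) n) ≡ dyckFormula k n)
mainTheorem7 (suc k′) (s≤s z≤n) = ballot , dyck
  where
  open FormulaRecurrence k′ using (F; F-satisfiesRecurrence)
  open PathRecurrence k′ using (ballotAvoid≡paths; paths-satisfiesRecurrence)

  k : ℕ
  k = suc k′

  ballotAvoid≡F : ∀ n d → ℕtoℚ (ballotAvoid (pat k) n (n + d)) ≡ ℤtoℚ (F n d)
  ballotAvoid≡F n d = cong ℤtoℚ (trans (cong +_ (ballotAvoid≡paths n d))
                                       (recurrence-unique paths-satisfiesRecurrence F-satisfiesRecurrence n d))

  F≡ballotFormula : ∀ n m → ℤtoℚ (F n (m ∸ n)) ≡ ballotFormula k n m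
  F≡ballotFormula n m =
    trans (sym (sumℚ-ℤtoℚ n (λ i → innerSum k n i ℤ.* + ballotNumber d i)))
          (trans (sumℚ-cong n (λ i → sym (ballotTerm≡ (innerSum k n i) d (d + i) ((d + 2 * i) C i)
                                                      (ballotNumber d i) (ballotNumber-closedForm d i))))
                 (sym (*-distribˡ-sumℚ n (ℕtoℚ (suc d)) _)))
    where
    d : ℕ
    d = m ∸ n

  F≡dyckFormula : ∀ n → ℤtoℚ (F n 0) ≡ dyckFormula k n
  F≡dyckFormula n =
    trans (sym (sumℚ-ℤtoℚ n (λ i → innerSum k n i ℤ.* + ballotNumber 0 i)))
          (sumℚ-cong n (λ i → sym (catalanTerm≡ (innerSum k n i) i ((2 * i) C i) (ballotNumber 0 i)
                                     (trans (sym (ℕP.*-identityˡ _)) (ballotNumber-closedForm 0 i)))))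

  ballot : (n m : ℕ) → n ≤ m → ℕtoℚ (ballotAvoid (pat k) n m) ≡ ballotFormula k n m
  ballot n m n≤m = trans (cong (λ m′ → ℕtoℚ (ballotAvoid (pat k) n m′)) (sym (ℕP.m+[n∸m]≡n n≤m)))
                         (trans (ballotAvoid≡F n (m ∸ n)) (F≡ballotFormula n m))

  dyck : (n : ℕ) → ℕtoℚ (dyckAvoid (pat k) n) ≡ dyckFormula k n
  dyck n = trans (cong (λ m → ℕtoℚ (ballotAvoid (pat k) n m)) (sym (ℕP.+-identityʳ n)))
                 (trans (ballotAvoid≡F n 0) (F≡dyckFormula n))
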